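{- Every connected $3$-regular permutation graph is isomorphic to $K_4$, to $K_{3,3}$, or to a boxcar graph.
   Context: All graphs are finite and simple. A graph $G$ on $n$ vertices is a permutation graph if there is a labeling $v_1, \ldots, v_n$ of its vertices and a permutation $\pi$ of $\{1,\ldots,n\}$ such that for $i<j$, $v_i$ and $v_j$ are adjacent iff $\pi(i) > \pi(j)$. Boxcar graphs are defined from four graphs: $G_1$ has vertices $x_1,x_2,y_1,y_2,z$ and edges $x_1x_2$, $x_iy_j$ ($i,j\in\{1,2\}$), $y_1z$, $y_2z$, with rightmost vertex $z$; $G_2$ has vertices $a,b,c_1,c_2,d$ and edges $ab, bc_1, bc_2, c_1c_2, c_1d, c_2d$; $G_3$ has vertices $a,b,c_1,c_2,e_1,e_2,d$ and edges $ab, bc_1, bc_2$, $c_ie_j$ ($i,j\in\{1,2\}$), $e_1d, e_2d$; $G_4$ has vertices $a,b,c_1,c_2,f_1,f_2$ and edges $ab, bc_1,bc_2$, $c_if_j$ ($i,j\in\{1,2\}$), $f_1f_2$. In $G_2,G_3,G_4$ the leftmost vertex is $a$, and in $G_2,G_3$ the rightmost vertex is $d$. A boxcar graph is obtained by starting with $S=G_1$ and repeatedly taking a new copy $S'$ of one of $G_2,G_3,G_4$, identifying the rightmost vertex of the current graph $S$ with the leftmost vertex of $S'$ (the new rightmost vertex being that of $S'$), and stopping as soon as a copy of $G_4$ has been attached; i.e. it is $G_1$ followed by a finite (possibly empty) sequence of copies of $G_2$ and $G_3$ in any order, followed by $G_4$, consecutive pieces glued at one vertex. -}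

module Defs where

open import Data.Nat using (ℕ; zero; suc; _+_; _≡ᵇ_; _<ᵇ_) renaming (_<_ to _<ℕ_)
open import Data.Bool using (Bool; true; false; if_then_else_; _∧_; _∨_; _xor_; not)
open import Data.Fin using (Fin; toℕ; _<_; _≟_)
open import Data.Fin.Permutation using (Permutation; Permutation′; _⟨$⟩ʳ_)
open import Data.List using (List; []; _∷_; _++_; map; allFin)
open import Data.Nat.ListAction using (sum)
open import Data.Bool.ListAction using (any)
open import Data.Product using (Σ; _×_; _,_; ∃)
open import Data.Sum using (_⊎_)
open import Relation.Binary.PropositionalEquality using (_≡_)
open import Relation.Nullary.Decidable using (⌊_⌋)
open import Function.Bundles using (_⇔_)

Graph : ℕ → Set
Graph n = Fin n → Fin n → Bool

IsSimple : ∀ {n} → Graph n → Set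
IsSimple {n} G = (∀ (u v : Fin n) → G u v ≡ G v u) × (∀ (v : Fin n) → G v v ≡ false)

degree : ∀ {n} → Graph n → Fin n → ℕ
degree {n} G v = sum (map (λ u → if G v u then 1 else 0) (allFin n))

IsRegular : ∀ {n} → ℕ → Graph n → Set
IsRegular {n} k G = ∀ (v : Fin n) → degree G v ≡ k

data Walk {n} (G : Graph n) : Fin n → Fin n → Set where
  here : ∀ {u} → Walk G u u
  step : ∀ {u w v} → G u w ≡ true → Walk G w v → Walk G u v

IsConnected : ∀ {n} → Graph n → Set
IsConnected {n} G = (0 <ℕ n) × (∀ (u v : Fin n) → Walk G u v)

IsPermutationGraph : ∀ {n} → Graph n → Set
IsPermutationGraph {n} G =
  Σ (Permutation′ n) λ σ → Σ (Permutation′ n) λ π →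
    ∀ (i j : Fin n) → i < j →
      ((G (σ ⟨$⟩ʳ i) (σ ⟨$⟩ʳ j) ≡ true) ⇔ (π ⟨$⟩ʳ j < π ⟨$⟩ʳ i))

Isomorphic : ∀ {n m} → Graph n → Graph m → Set
Isomorphic {n} {m} G H =
  Σ (Permutation n m) λ f → ∀ (u v : Fin n) → G u v ≡ H (f ⟨$⟩ʳ u) (f ⟨$⟩ʳ v)

K4 : Graph 4
K4 u v = not ⌊ u ≟ v ⌋

K33 : Graph 6
K33 u v = (toℕ u <ᵇ 3) xor (toℕ v <ᵇ 3)

-- Boxcar graphs. Vertices are numbered by naturals.
-- G1: x1=0, x2=1, y1=2, y2=3, z=4 (rightmost 4).
-- A car glued at rightmost vertex r has leftmost vertex a = r and new
-- vertices r+1, r+2, ...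

data Car : Set where
  car2 car3 : Car

Edges : Set
Edges = List (ℕ × ℕ)

g1Edges : Edges
g1Edges = (0 , 1) ∷ (0 , 2) ∷ (0 , 3) ∷ (1 , 2) ∷ (1 , 3) ∷ (2 , 4) ∷ (3 , 4) ∷ []

-- G2: a=r, b=r+1, c1=r+2, c2=r+3, d=r+4
g2Edges : ℕ → Edges
g2Edges r = (r , r + 1) ∷ (r + 1 , r + 2) ∷ (r + 1 , r + 3) ∷ (r + 2 , r + 3)
          ∷ (r + 2 , r + 4) ∷ (r + 3 , r + 4) ∷ []

-- G3: a=r, b=r+1, c1=r+2, c2=r+3, e1=r+4, e2=r+5, d=r+6
g3Edges : ℕ → Edges
g3Edges r = (r , r + 1) ∷ (r + 1 , r + 2) ∷ (r + 1 , r + 3)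
          ∷ (r + 2 , r + 4) ∷ (r + 2 , r + 5) ∷ (r + 3 , r + 4) ∷ (r + 3 , r + 5)
          ∷ (r + 4 , r + 6) ∷ (r + 5 , r + 6) ∷ []

-- G4: a=r, b=r+1, c1=r+2, c2=r+3, f1=r+4, f2=r+5
g4Edges : ℕ → Edges
g4Edges r = (r , r + 1) ∷ (r + 1 , r + 2) ∷ (r + 1 , r + 3)
          ∷ (r + 2 , r + 4) ∷ (r + 2 , r + 5) ∷ (r + 3 , r + 4) ∷ (r + 3 , r + 5)
          ∷ (r + 4 , r + 5) ∷ []

rightEnd : ℕ → List Car → ℕ
rightEnd r [] = r
rightEnd r (car2 ∷ cs) = rightEnd (r + 4) cs
rightEnd r (car3 ∷ cs) = rightEnd (r + 6) cs

carsEdges : ℕ → List Car → Edges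
carsEdges r [] = g4Edges r
carsEdges r (car2 ∷ cs) = g2Edges r ++ carsEdges (r + 4) cs
carsEdges r (car3 ∷ cs) = g3Edges r ++ carsEdges (r + 6) cs

boxcarEdges : List Car → Edges
boxcarEdges cs = g1Edges ++ carsEdges 4 cs

-- number of vertices: 0 .. rightEnd 4 cs + 5
boxcarSize : List Car → ℕ
boxcarSize cs = rightEnd 4 cs + 6

edgeAdj : Edges → ℕ → ℕ → Bool
edgeAdj es u v = any (λ { (a , b) → ((a ≡ᵇ u) ∧ (b ≡ᵇ v)) ∨ ((a ≡ᵇ v) ∧ (b ≡ᵇ u)) }) es

boxcar : (cs : List Car) → Graph (boxcarSize cs)
boxcar cs u v = edgeAdj (boxcarEdges cs) (toℕ u) (toℕ v)

IsBoxcar : ∀ {n} → Graph n → Set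
IsBoxcar G = ∃ λ (cs : List Car) → Isomorphic G (boxcar cs)

module Submission where

-- Order the vertices by σ and write P x for the π-value of the x-th vertex, so that positions
-- x < y are adjacent iff P y < P x. Counting the values below P x gives P x = A + R and x = A + L,
-- where L and R are the numbers of neighbours to the left and to the right of x; since L + R = 3,
-- P x + 2 L = x + 3. Every vertex is thus displaced by +3, +1, -1 or -3, and the graph is the
-- graph of its word of displacements: x < y are adjacent iff y - x is less than the drop in
-- displacement, so only the six preceding letters matter. Bijectivity of P, the degree count and
-- connectivity (some edge crosses between every two consecutive positions) are checks on these
-- windows, so the word is accepted by a finite automaton. Exploring the automaton shows that an
-- accepted word is the word of K4, of K3,3 or of a boxcar graph, whose blocks are relabelled onto
-- the cars, or else starts with displacements +3 +3 -1 -3. In that case exchanging the roles of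
-- σ and π represents the same graph by a word that cannot start that way.

open import Data.Bool using (Bool; true; false; T; not; _∧_; _∨_; if_then_else_)
open import Data.Bool.ListAction using (all; any)
open import Data.Bool.Properties using (T-∧; T-∨)
open import Data.Empty using (⊥-elim)
open import Data.Fin using (Fin; toℕ; fromℕ<) renaming (_<_ to _<F_)
open import Data.Fin.Permutation using (Permutation′; Permutation; _⟨$⟩ʳ_; _⟨$⟩ˡ_; inverseˡ; inverseʳ; permutation; flip; _∘ₚ_)
open import Data.List using (List; []; _∷_; _++_; foldl; length; map)
open import Data.List.Membership.DecPropositional using () renaming (_∈?_ to member?)
open import Data.List.Membership.Propositional using (_∈_; find)
open import Data.List.Properties using (length-++)
open import Data.List.Relation.Unary.All using (All; []; _∷_) renaming (lookup to lookupAll)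
open import Data.List.Relation.Unary.All.Properties using (all⁺)
open import Data.List.Relation.Unary.Any using (here; there)
open import Data.List.Relation.Unary.Any.Properties using (any⁻)
open import Data.Nat using (ℕ; zero; suc; pred; _+_; _*_; _∸_; _≡ᵇ_; _<ᵇ_; _≤_; _<_; z≤n; s≤s; _≤?_; _<?_)
import Data.Nat as ℕ
open import Data.Nat.Properties using (≤-trans; +-monoˡ-≤; ≤-pred; m≤m+n; ≤-refl; <-trans)
open import Data.Product using (Σ; _×_; _,_; proj₁; proj₂)
import Data.Product
open import Data.Sum using (_⊎_; inj₁; inj₂)
open import Data.Vec using (Vec; []; _∷_)
import Data.Vec.Properties as Vec
open import Defs
open import Function using (const; id)
open import Function.Bundles using (_⇔_; Equivalence; mk⇔)
open import Relation.Binary.Definitions using (DecidableEquality; tri<; tri≈; tri>)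
open import Relation.Binary.PropositionalEquality using (_≡_; _≢_; refl; cong; cong₂; sym; trans; subst; subst₂)
open import Relation.Nullary using (yes; no; ¬_)
open import Relation.Nullary.Decidable using (True; toWitness; map′; ⌊_⌋)
open import Relation.Nullary.Negation using (contradiction)
open Relation.Binary.PropositionalEquality.≡-Reasoning

module BoolFacts where

  open import Data.Bool.Properties using (T-≡)
  open import Data.Nat.Properties using (<⇒<ᵇ; <ᵇ⇒<; <⇒≱; ≡⇒≡ᵇ; ≡ᵇ⇒≡; ≤⇒≤ᵇ; ≤ᵇ⇒≤)

  T-∧-intro : ∀ {x y} → T x → T y → T (x ∧ y)
  T-∧-intro tx ty = Equivalence.from T-∧ (tx , ty)

  T-∨-introˡ : ∀ {x y} → T x → T (x ∨ y)
  T-∨-introˡ tx = Equivalence.from T-∨ (inj₁ tx)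

  T-∨-introʳ : ∀ {x y} → T y → T (x ∨ y)
  T-∨-introʳ ty = Equivalence.from T-∨ (inj₂ ty)

  T⇒≡ : ∀ {x} → T x → x ≡ true
  T⇒≡ = Equivalence.to T-≡

  ≡⇒T : ∀ {x} → x ≡ true → T x
  ≡⇒T = Equivalence.from T-≡

  T-extensional : ∀ {x y} → (T x → T y) → (T y → T x) → x ≡ y
  T-extensional {true} {true} f g = refl
  T-extensional {true} {false} f g = ⊥-elim (f _)
  T-extensional {false} {true} f g = ⊥-elim (g _)
  T-extensional {false} {false} f g = refl

  <ᵇ-true : ∀ {a b} → a < b → (a <ᵇ b) ≡ true
  <ᵇ-true q = T⇒≡ (<⇒<ᵇ q)

  <ᵇ-false : ∀ {a b} → b ≤ a → (a <ᵇ b) ≡ false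
  <ᵇ-false {a} {b} q with a <ᵇ b in eq
  ... | false = refl
  ... | true = ⊥-elim (<⇒≱ (<ᵇ⇒< a b (≡⇒T eq)) q)

  <ᵇ-irr : ∀ a → (a <ᵇ a) ≡ false
  <ᵇ-irr a = <ᵇ-false {a} {a} ≤-refl

  <ᵇ-cong : ∀ {a b c d} → (a < b → c < d) → (c < d → a < b) → (a <ᵇ b) ≡ (c <ᵇ d)
  <ᵇ-cong {a} {b} {c} {d} f g = T-extensional (λ t → <⇒<ᵇ (f (<ᵇ⇒< a b t))) (λ t → <⇒<ᵇ (g (<ᵇ⇒< c d t)))

  ≡ᵇ-true : ∀ {a b} → a ≡ b → (a ≡ᵇ b) ≡ true
  ≡ᵇ-true {a} refl = T⇒≡ (≡⇒≡ᵇ a a refl)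

  ≡ᵇ-false : ∀ {a b} → a ≢ b → (a ≡ᵇ b) ≡ false
  ≡ᵇ-false {a} {b} ne with a ≡ᵇ b in eq
  ... | false = refl
  ... | true = ⊥-elim (ne (≡ᵇ⇒≡ a b (≡⇒T eq)))

  ≤ᵇ-true : ∀ {a b} → a ≤ b → (a Data.Nat.≤ᵇ b) ≡ true
  ≤ᵇ-true {a} {b} q = T⇒≡ (≤⇒≤ᵇ q)

  ≤ᵇ-false : ∀ {a b} → b < a → (a Data.Nat.≤ᵇ b) ≡ false
  ≤ᵇ-false {a} {b} q with a Data.Nat.≤ᵇ b in eq
  ... | false = refl
  ... | true = ⊥-elim (<⇒≱ q (≤ᵇ⇒≤ a b (≡⇒T eq)))

  T-not : ∀ {b} → b ≡ false → T (not b)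
  T-not refl = _

  T-not-not : ∀ {b} → T b → T (not (not b))
  T-not-not {true} t = _

module Parsing {A S : Set} (_≟_ : DecidableEquality A)
  (alphabet : List A) (∈-alphabet : ∀ a → a ∈ alphabet)
  (step : S → A → S) (continues ends : S → A → Bool) where

  data Accepts (s : S) : List A → Set where
    [_] : ∀ {a} → T (ends s a) → Accepts s (a ∷ [])
    _∷_ : ∀ {a as} → T (continues s a) → Accepts (step s a) as → Accepts s (a ∷ as)

  run : S → List A → S
  run = foldl step

  data Next : Set where
    stop : Next
    continueIf : (S → Bool) → Next

  Pattern : Set
  Pattern = List (List A × Next)

  derivative : A → Pattern → Pattern
  derivative a [] = []
  derivative a (([] , k) ∷ ps) = derivative a ps
  derivative a ((b ∷ u , k) ∷ ps) with b ≟ a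
  ... | yes _ = (u , k) ∷ derivative a ps
  ... | no _ = derivative a ps

  ∈-derivative : ∀ {a u k} ps → (u , k) ∈ derivative a ps → (a ∷ u , k) ∈ ps
  ∈-derivative (([] , _) ∷ ps) m = there (∈-derivative ps m)
  ∈-derivative {a} ((b ∷ _ , _) ∷ ps) m with b ≟ a
  ∈-derivative ((_ ∷ _ , _) ∷ ps) (here refl) | yes refl = here refl
  ∈-derivative ((_ ∷ _ , _) ∷ ps) (there m)   | yes _    = there (∈-derivative ps m)
  ∈-derivative ((_ ∷ _ , _) ∷ ps) m           | no _     = there (∈-derivative ps m)

  stopsNow : List A × Next → Bool
  stopsNow ([] , stop) = true
  stopsNow _ = false

  continuesNow : S → List A × Next → Bool
  continuesNow s ([] , continueIf t) = t s
  continuesNow s _ = false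

  mutual
    Covers : ℕ → S → Pattern → Bool
    Covers zero s ps = false
    Covers (suc n) s ps = all (CoversAt n s ps) alphabet

    CoversAt : ℕ → S → Pattern → A → Bool
    CoversAt n s ps a = (not (ends s a) ∨ any stopsNow (derivative a ps))
      ∧ (not (continues s a) ∨ (any (continuesNow (step s a)) (derivative a ps) ∨ Covers n (step s a) (derivative a ps)))

  data Parse (s : S) (ps : Pattern) : List A → Set where
    stopped : ∀ {u} → (u , stop) ∈ ps → Parse s ps u
    continued : ∀ {u t v} → (u , continueIf t) ∈ ps → T (t (run s u)) → Accepts (run s u) v → Parse s ps (u ++ v)

  private
    modusPonens : ∀ {x y} → T (not x ∨ y) → T x → T y
    modusPonens {true} t _ = t

  parse : ∀ n {s ps as} → T (Covers n s ps) → Accepts s as → Parse s ps as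
  parse (suc n) {s} {ps} {a ∷ _} c acc = go acc
    where
    here-a : T (CoversAt n s ps a)
    here-a = lookupAll (all⁺ _ alphabet c) (∈-alphabet a)
    ps′ : Pattern
    ps′ = derivative a ps
    go : ∀ {as} → Accepts s (a ∷ as) → Parse s ps (a ∷ as)
    go [ e ] with find (any⁻ stopsNow ps′ (modusPonens (Equivalence.to T-∧ here-a .proj₁) e))
    ... | ([] , stop) , m , _ = stopped (∈-derivative ps m)
    go (k ∷ acc′) with Equivalence.to T-∨ (modusPonens (Equivalence.to T-∧ here-a .proj₂) k)
    ... | inj₁ now with find (any⁻ (continuesNow (step s a)) ps′ now)
    ...   | ([] , continueIf t) , m , tt′ = continued (∈-derivative ps m) tt′ acc′
    go (k ∷ acc′) | inj₂ later with parse n later acc′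
    ...   | stopped m = stopped (∈-derivative ps m)
    ...   | continued m t acc″ = continued (∈-derivative ps m) t acc″

module Sums where

  open import Data.Nat.Properties using (+-assoc; +-0-commutativeMonoid)
  open import Data.Fin using (zero; suc)
  open import Data.List using (tabulate)
  open import Data.Nat.ListAction using (sum)
  open import Function using (_∘_)
  import Algebra.Properties.CommutativeMonoid.Sum as CMS
  open import Data.Nat.Tactic.RingSolver using (solve-∀)

  indicator : Bool → ℕ
  indicator b = if b then 1 else 0

  open CMS +-0-commutativeMonoid public using () renaming (sum to ∑; sum-permute to ∑-permute; sum-cong-≗ to ∑-cong)

  sum-tabulate : ∀ {n} {A : Set} (g : A → ℕ) (f : Fin n → A) → sum (map g (tabulate f)) ≡ ∑ (g ∘ f)
  sum-tabulate {zero} g f = refl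
  sum-tabulate {suc n} g f = cong (g (f zero) +_) (sum-tabulate g (f ∘ suc))

  degree≡∑ : ∀ {n} (G : Graph n) v → degree G v ≡ ∑ (λ u → indicator (G v u))
  degree≡∑ G v = sum-tabulate (λ u → if G v u then 1 else 0) id

  sumBelow : (ℕ → ℕ) → ℕ → ℕ
  sumBelow f zero = 0
  sumBelow f (suc m) = f 0 + sumBelow (f ∘ suc) m

  extendFin : ∀ {n} → (Fin n → ℕ) → ℕ → ℕ
  extendFin {zero} h x = 0
  extendFin {suc n} h zero = h zero
  extendFin {suc n} h (suc x) = extendFin (h ∘ suc) x

  extendFin-toℕ : ∀ {n} (h : Fin n → ℕ) i → extendFin h (toℕ i) ≡ h i
  extendFin-toℕ h zero = refl
  extendFin-toℕ h (suc i) = extendFin-toℕ (h ∘ suc) i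

  ∑≡sumBelow : ∀ {n} (h : Fin n → ℕ) → ∑ h ≡ sumBelow (extendFin h) n
  ∑≡sumBelow {zero} h = refl
  ∑≡sumBelow {suc n} h = cong (h zero +_) (∑≡sumBelow (h ∘ suc))

  sumBelow-cong : ∀ f g m → (∀ x → x < m → f x ≡ g x) → sumBelow f m ≡ sumBelow g m
  sumBelow-cong f g zero h = refl
  sumBelow-cong f g (suc m) h = cong₂ _+_ (h 0 (s≤s z≤n)) (sumBelow-cong (f ∘ suc) (g ∘ suc) m (λ x p → h (suc x) (s≤s p)))

  sumBelow-+ : ∀ f g m → sumBelow (λ x → f x + g x) m ≡ sumBelow f m + sumBelow g m
  sumBelow-+ f g zero = refl
  sumBelow-+ f g (suc m) = trans (cong (f 0 + g 0 +_) (sumBelow-+ (f ∘ suc) (g ∘ suc) m)) (interchange (f 0) (g 0) (sumBelow (f ∘ suc) m) (sumBelow (g ∘ suc) m))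
    where
    interchange : ∀ a b c d → a + b + (c + d) ≡ a + c + (b + d)
    interchange = solve-∀

  sumBelow-+ₙ : ∀ f a b → sumBelow f (a + b) ≡ sumBelow f a + sumBelow (λ x → f (a + x)) b
  sumBelow-+ₙ f zero b = refl
  sumBelow-+ₙ f (suc a) b = trans (cong (f 0 +_) (sumBelow-+ₙ (f ∘ suc) a b)) (sym (+-assoc (f 0) _ _))

  sumBelow-1 : ∀ m → sumBelow (λ _ → 1) m ≡ m
  sumBelow-1 zero = refl
  sumBelow-1 (suc m) = cong suc (sumBelow-1 m)

  sumBelow-0 : ∀ m → sumBelow (λ _ → 0) m ≡ 0
  sumBelow-0 zero = refl
  sumBelow-0 (suc m) = sumBelow-0 m

  sumBelow≡0⇒ : ∀ f m → sumBelow f m ≡ 0 → ∀ x → x < m → f x ≡ 0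
  sumBelow≡0⇒ f (suc m) h zero p with f 0 | h
  ... | zero | _ = refl
  sumBelow≡0⇒ f (suc m) h (suc x) (s≤s p) with f 0 | h
  ... | zero | h' = sumBelow≡0⇒ (f ∘ suc) m h' x p

module BlockMaps where

  open import Data.Nat.Properties using (+-suc; ≡ᵇ⇒≡; <ᵇ⇒<; ≤-<-connex; m+[n∸m]≡n; +-monoʳ-<; +-cancelˡ-<)
  open import Data.List using (upTo)
  open import Data.List.Membership.Propositional.Properties using (∈-applyUpTo⁺)
  open import Data.List.Relation.Unary.All using () renaming (lookup to lookupAll)
  open import Function using (_∘_)
  import Relation.Binary.PropositionalEquality
  open Relation.Binary.PropositionalEquality using (_≡_; refl; sym; trans; cong; cong₂; subst)

  blockMap : List ℕ → (ℕ → ℕ) → ℕ → ℕ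
  blockMap [] F y = F y
  blockMap (p ∷ ps) F zero = p
  blockMap (p ∷ ps) F (suc x) = blockMap ps (suc ∘ F) x

  blockMap-+ : ∀ ps F y → blockMap ps F (length ps + y) ≡ length ps + F y
  blockMap-+ [] F y = refl
  blockMap-+ (p ∷ ps) F y = trans (blockMap-+ ps (suc ∘ F) y) (+-suc (length ps) (F y))

  blockMap-head : ∀ ps F G {x} → x < length ps → blockMap ps F x ≡ blockMap ps G x
  blockMap-head (p ∷ ps) F G {zero} _ = refl
  blockMap-head (p ∷ ps) F G {suc x} (s≤s x<) = blockMap-head ps (suc ∘ F) (suc ∘ G) x<

  InverseOn : ℕ → List ℕ → List ℕ → Set
  InverseOn k ps qs = T (all (λ x → (blockMap qs id x <ᵇ k) ∧ (blockMap ps id (blockMap qs id x) ≡ᵇ x)) (upTo k))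

  record BlockBijection (k : ℕ) (ps qs : List ℕ) : Set where
    field
      length-ps : length ps ≡ k
      length-qs : length qs ≡ k
      ps∘qs : InverseOn k ps qs
      qs∘ps : InverseOn k qs ps

  BlockBijection-sym : ∀ {k ps qs} → BlockBijection k ps qs → BlockBijection k qs ps
  BlockBijection-sym b = record { length-ps = length-qs ; length-qs = length-ps ; ps∘qs = qs∘ps ; qs∘ps = ps∘qs }
    where open BlockBijection b

  InverseOn-at : ∀ {k} ps qs {x} → InverseOn k ps qs → x < k → (blockMap qs id x < k) × (blockMap ps id (blockMap qs id x) ≡ x)
  InverseOn-at {k} ps qs {x} inv x<k with Equivalence.to T-∧ (lookupAll (all⁺ _ (upTo k) inv) (∈-applyUpTo⁺ id x<k))
  ... | bounded , inverse = <ᵇ⇒< _ _ bounded , ≡ᵇ⇒≡ _ _ inverse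

  module _ {k ps qs} (b : BlockBijection k ps qs) where
    open BlockBijection b

    blockMap-bounded : ∀ {F L} → (∀ y → y < L → F y < L) → ∀ x → x < k + L → blockMap ps F x < k + L
    blockMap-bounded {F} {L} FL x x< with ≤-<-connex k x
    ... | inj₂ x<k = ≤-trans (subst (_< k) (blockMap-head ps id F (subst (x <_) (sym length-ps) x<k)) (proj₁ (InverseOn-at qs ps qs∘ps x<k))) (m≤m+n k L)
    ... | inj₁ k≤x = subst (_< k + L) (sym tail) (+-monoʳ-< k (FL (x ∸ k) (+-cancelˡ-< k _ _ (subst (_< k + L) (sym (m+[n∸m]≡n k≤x)) x<))))
      where
      tail : blockMap ps F x ≡ k + F (x ∸ k)
      tail = begin
        blockMap ps F x                   ≡⟨ cong (blockMap ps F) (sym (m+[n∸m]≡n k≤x)) ⟩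
        blockMap ps F (k + (x ∸ k))       ≡⟨ cong (λ m → blockMap ps F (m + (x ∸ k))) (sym length-ps) ⟩
        blockMap ps F (length ps + (x ∸ k)) ≡⟨ blockMap-+ ps F (x ∸ k) ⟩
        length ps + F (x ∸ k)             ≡⟨ cong (_+ F (x ∸ k)) length-ps ⟩
        k + F (x ∸ k)                     ∎

    blockMap-inverse : ∀ {F G} → (∀ y → F (G y) ≡ y) → ∀ x → blockMap ps F (blockMap qs G x) ≡ x
    blockMap-inverse {F} {G} FG x with ≤-<-connex k x
    ... | inj₂ x<k = begin
      blockMap ps F (blockMap qs G x)   ≡⟨ cong (blockMap ps F) (blockMap-head qs G id (subst (x <_) (sym length-qs) x<k)) ⟩
      blockMap ps F (blockMap qs id x)  ≡⟨ blockMap-head ps F id (subst (_ <_) (sym length-ps) (proj₁ (InverseOn-at ps qs ps∘qs x<k))) ⟩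
      blockMap ps id (blockMap qs id x) ≡⟨ proj₂ (InverseOn-at ps qs ps∘qs x<k) ⟩
      x                                 ∎
    ... | inj₁ k≤x = begin
      blockMap ps F (blockMap qs G x)                ≡⟨ cong (λ z → blockMap ps F (blockMap qs G z)) (sym x≡) ⟩
      blockMap ps F (blockMap qs G (length qs + y))  ≡⟨ cong (blockMap ps F) (blockMap-+ qs G y) ⟩
      blockMap ps F (length qs + G y)                ≡⟨ cong (λ m → blockMap ps F (m + G y)) (trans length-qs (sym length-ps)) ⟩
      blockMap ps F (length ps + G y)                ≡⟨ blockMap-+ ps F (G y) ⟩
      length ps + F (G y)                            ≡⟨ cong₂ _+_ (trans length-ps (sym length-qs)) (FG y) ⟩
      length qs + y                                  ≡⟨ x≡ ⟩
      x                                              ∎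
      where
      y : ℕ
      y = x ∸ k
      x≡ : length qs + y ≡ x
      x≡ = trans (cong (_+ y) length-qs) (m+[n∸m]≡n k≤x)

module EdgeLists where

  open import Data.Nat.Properties using (≡ᵇ⇒≡; ≡⇒≡ᵇ; +-assoc; m+[n∸m]≡n; ≤-<-connex)
  open import Data.Bool.Properties using (∨-assoc; ∨-comm)
  open import Data.List.Properties using (map-++)
  open BoolFacts

  joins : ℕ → ℕ → (ℕ × ℕ) → Bool
  joins u v (a , b) = ((a ≡ᵇ u) ∧ (b ≡ᵇ v)) ∨ ((a ≡ᵇ v) ∧ (b ≡ᵇ u))

  edgeAdj-++ : ∀ A B u v → edgeAdj (A ++ B) u v ≡ edgeAdj A u v ∨ edgeAdj B u v
  edgeAdj-++ [] B u v = refl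
  edgeAdj-++ (x ∷ A) B u v = trans (cong (joins u v x ∨_) (edgeAdj-++ A B u v)) (sym (∨-assoc (joins u v x) _ _))

  joins-sym : ∀ u v x → joins u v x ≡ joins v u x
  joins-sym u v (a , b) = ∨-comm ((a ≡ᵇ u) ∧ (b ≡ᵇ v)) _

  edgeAdj-sym : ∀ A u v → edgeAdj A u v ≡ edgeAdj A v u
  edgeAdj-sym [] u v = refl
  edgeAdj-sym (x ∷ A) u v = cong₂ _∨_ (joins-sym u v x) (edgeAdj-sym A u v)

  record SameEdges (A B : Edges) : Set where
    constructor sameEdges
    field edgeAdj-≡ : ∀ u v → edgeAdj A u v ≡ edgeAdj B u v
  open SameEdges public

  SameEdges-refl : ∀ {A} → SameEdges A A
  SameEdges-refl = sameEdges λ u v → refl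

  SameEdges-sym : ∀ {A B} → SameEdges A B → SameEdges B A
  SameEdges-sym e = sameEdges λ u v → sym (edgeAdj-≡ e u v)

  SameEdges-trans : ∀ {A B C} → SameEdges A B → SameEdges B C → SameEdges A C
  SameEdges-trans e f = sameEdges λ u v → trans (edgeAdj-≡ e u v) (edgeAdj-≡ f u v)

  ≡⇒SameEdges : ∀ {A B} → A ≡ B → SameEdges A B
  ≡⇒SameEdges refl = SameEdges-refl

  SameEdges-++ : ∀ {A A' B B'} → SameEdges A A' → SameEdges B B' → SameEdges (A ++ B) (A' ++ B')
  SameEdges-++ {A} {A'} {B} {B'} e f = sameEdges λ u v → trans (edgeAdj-++ A B u v) (trans (cong₂ _∨_ (edgeAdj-≡ e u v) (edgeAdj-≡ f u v)) (sym (edgeAdj-++ A' B' u v)))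

  includedᵇ : Edges → Edges → Bool
  includedᵇ [] B = true
  includedᵇ ((a , b) ∷ A) B = edgeAdj B a b ∧ includedᵇ A B

  includedᵇ-sound : ∀ A B u v → T (includedᵇ A B) → T (edgeAdj A u v) → T (edgeAdj B u v)
  includedᵇ-sound [] B u v s ()
  includedᵇ-sound ((a , b) ∷ A) B u v s e with Equivalence.to (T-∧ {edgeAdj B a b}) s | Equivalence.to (T-∨ {joins u v (a , b)}) e
  ... | _ , A⊆B | inj₂ e′ = includedᵇ-sound A B u v A⊆B e′
  ... | ab∈B , _ | inj₁ j with Equivalence.to T-∨ j
  ...   | inj₁ a≡u∧b≡v = subst₂ (λ x y → T (edgeAdj B x y)) (≡ᵇ⇒≡ a u (proj₁ uv)) (≡ᵇ⇒≡ b v (proj₂ uv)) ab∈B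
    where uv = Equivalence.to T-∧ a≡u∧b≡v
  ...   | inj₂ a≡v∧b≡u = subst₂ (λ x y → T (edgeAdj B y x)) (≡ᵇ⇒≡ a v (proj₁ vu)) (≡ᵇ⇒≡ b u (proj₂ vu)) (subst T (edgeAdj-sym B a b) ab∈B)
    where vu = Equivalence.to T-∧ a≡v∧b≡u

  SameEdges-by-inclusion : ∀ A B → T (includedᵇ A B) → T (includedᵇ B A) → SameEdges A B
  SameEdges-by-inclusion A B s t = sameEdges λ u v → T-extensional (includedᵇ-sound A B u v s) (includedᵇ-sound B A u v t)

  shiftPair : ℕ → ℕ × ℕ → ℕ × ℕ
  shiftPair s (a , b) = (s + a , s + b)

  shiftEdges : ℕ → Edges → Edges
  shiftEdges s = map (shiftPair s)

  shiftEdges-++ : ∀ s A B → shiftEdges s (A ++ B) ≡ shiftEdges s A ++ shiftEdges s B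
  shiftEdges-++ s A B = map-++ (shiftPair s) A B

  shiftEdges-+ : ∀ a b A → shiftEdges a (shiftEdges b A) ≡ shiftEdges (a + b) A
  shiftEdges-+ a b [] = refl
  shiftEdges-+ a b ((x , y) ∷ A) = cong₂ _∷_ (cong₂ _,_ (sym (+-assoc a b x)) (sym (+-assoc a b y))) (shiftEdges-+ a b A)

  ≡ᵇ-shift : ∀ s a u → ((s + a) ≡ᵇ (s + u)) ≡ (a ≡ᵇ u)
  ≡ᵇ-shift zero a u = refl
  ≡ᵇ-shift (suc s) a u = ≡ᵇ-shift s a u

  ≡ᵇ-below : ∀ s a u → u < s → ((s + a) ≡ᵇ u) ≡ false
  ≡ᵇ-below (suc s) a zero p = refl
  ≡ᵇ-below (suc s) a (suc u) (s≤s p) = ≡ᵇ-below s a u p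

  edgeAdj-shift : ∀ s A u v → edgeAdj (shiftEdges s A) (s + u) (s + v) ≡ edgeAdj A u v
  edgeAdj-shift s [] u v = refl
  edgeAdj-shift s ((a , b) ∷ A) u v =
    cong₂ _∨_ (cong₂ _∨_ (cong₂ _∧_ (≡ᵇ-shift s a u) (≡ᵇ-shift s b v)) (cong₂ _∧_ (≡ᵇ-shift s a v) (≡ᵇ-shift s b u)))
              (edgeAdj-shift s A u v)

  ∧f : ∀ x → (x ∧ false) ≡ false
  ∧f true = refl
  ∧f false = refl

  edgeAdj-shift-below : ∀ s A u v → u < s → edgeAdj (shiftEdges s A) u v ≡ false
  edgeAdj-shift-below s [] u v p = refl
  edgeAdj-shift-below s ((a , b) ∷ A) u v p
    rewrite ≡ᵇ-below s a u p | ≡ᵇ-below s b u p | ∧f ((s + a) ≡ᵇ v) = edgeAdj-shift-below s A u v p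

  SameEdges-shift : ∀ s {A B} → SameEdges A B → SameEdges (shiftEdges s A) (shiftEdges s B)
  SameEdges-shift s {A} {B} e = sameEdges (go)
    where
    go : ∀ u v → edgeAdj (shiftEdges s A) u v ≡ edgeAdj (shiftEdges s B) u v
    go u v with ≤-<-connex s u
    ... | inj₂ u<s = trans (edgeAdj-shift-below s A u v u<s) (sym (edgeAdj-shift-below s B u v u<s))
    ... | inj₁ s≤u with ≤-<-connex s v
    ...   | inj₂ v<s = trans (edgeAdj-sym (shiftEdges s A) u v) (trans (edgeAdj-shift-below s A v u v<s)
                          (sym (trans (edgeAdj-sym (shiftEdges s B) u v) (edgeAdj-shift-below s B v u v<s))))
    ...   | inj₁ s≤v = subst₂' (m+[n∸m]≡n s≤u) (m+[n∸m]≡n s≤v)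
      where
      subst₂' : ∀ {u' v'} → s + (u ∸ s) ≡ u' → s + (v ∸ s) ≡ v' → edgeAdj (shiftEdges s A) u' v' ≡ edgeAdj (shiftEdges s B) u' v'
      subst₂' refl refl = trans (edgeAdj-shift s A (u ∸ s) (v ∸ s)) (trans (edgeAdj-≡ e (u ∸ s) (v ∸ s)) (sym (edgeAdj-shift s B (u ∸ s) (v ∸ s))))

  mapPair : (ℕ → ℕ) → ℕ × ℕ → ℕ × ℕ
  mapPair f (a , b) = (f a , f b)

  ≡ᵇ-map-injective : ∀ (f : ℕ → ℕ) → (∀ x y → f x ≡ f y → x ≡ y) → ∀ a u → (f a ≡ᵇ f u) ≡ (a ≡ᵇ u)
  ≡ᵇ-map-injective f inj a u = T-extensional (λ t → ≡⇒≡ᵇ a u (inj a u (≡ᵇ⇒≡ _ _ t))) (λ t → ≡⇒≡ᵇ (f a) (f u) (cong f (≡ᵇ⇒≡ _ _ t)))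

  edgeAdj-map : ∀ f → (∀ x y → f x ≡ f y → x ≡ y) → ∀ A u v → edgeAdj (map (mapPair f) A) (f u) (f v) ≡ edgeAdj A u v
  edgeAdj-map f inj [] u v = refl
  edgeAdj-map f inj ((a , b) ∷ A) u v =
    cong₂ _∨_ (cong₂ _∨_ (cong₂ _∧_ (≡ᵇ-map-injective f inj a u) (≡ᵇ-map-injective f inj b v)) (cong₂ _∧_ (≡ᵇ-map-injective f inj a v) (≡ᵇ-map-injective f inj b u)))
              (edgeAdj-map f inj A u v)

module Words where

  open Sums using (indicator)

  -- The letter of the vertex at position x has value P x + 3 - x; a3 stands for a position before the first vertex.
  data Letter : Set where
    a0 a2 a3 a4 a6 : Letter

  val : Letter → ℕ
  val a0 = 0
  val a2 = 2
  val a3 = 3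
  val a4 = 4
  val a6 = 6

  ofVal : ℕ → Letter
  ofVal 0 = a0
  ofVal 2 = a2
  ofVal 3 = a3
  ofVal 4 = a4
  ofVal _ = a6

  ofVal-val : ∀ l → ofVal (val l) ≡ l
  ofVal-val a0 = refl
  ofVal-val a2 = refl
  ofVal-val a3 = refl
  ofVal-val a4 = refl
  ofVal-val a6 = refl

  _≟ₗ_ : DecidableEquality Letter
  l ≟ₗ m = map′ (λ e → trans (sym (ofVal-val l)) (trans (cong ofVal e) (ofVal-val m))) (cong val) (val l ℕ.≟ val m)

  letters : List Letter
  letters = a0 ∷ a2 ∷ a3 ∷ a4 ∷ a6 ∷ []

  ∈-letters : ∀ l → l ∈ letters
  ∈-letters a0 = here refl
  ∈-letters a2 = there (here refl)
  ∈-letters a3 = there (there (here refl))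
  ∈-letters a4 = there (there (there (here refl)))
  ∈-letters a6 = there (there (there (there (here refl))))

  Window : Set
  Window = Vec Letter 6

  push : Window → Letter → Window
  push (x1 ∷ x2 ∷ x3 ∷ x4 ∷ x5 ∷ x6 ∷ []) l = l ∷ x1 ∷ x2 ∷ x3 ∷ x4 ∷ x5 ∷ []

  blankWindow : Window
  blankWindow = a3 ∷ a3 ∷ a3 ∷ a3 ∷ a3 ∷ a3 ∷ []

  lookback : Window → ℕ → Letter
  lookback (x1 ∷ x2 ∷ x3 ∷ x4 ∷ x5 ∷ x6 ∷ []) 1 = x1
  lookback (x1 ∷ x2 ∷ x3 ∷ x4 ∷ x5 ∷ x6 ∷ []) 2 = x2
  lookback (x1 ∷ x2 ∷ x3 ∷ x4 ∷ x5 ∷ x6 ∷ []) 3 = x3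
  lookback (x1 ∷ x2 ∷ x3 ∷ x4 ∷ x5 ∷ x6 ∷ []) 4 = x4
  lookback (x1 ∷ x2 ∷ x3 ∷ x4 ∷ x5 ∷ x6 ∷ []) 5 = x5
  lookback (x1 ∷ x2 ∷ x3 ∷ x4 ∷ x5 ∷ x6 ∷ []) _ = x6

  all6 : (ℕ → Bool) → Bool
  all6 f = f 1 ∧ (f 2 ∧ (f 3 ∧ (f 4 ∧ (f 5 ∧ f 6))))

  any6 : (ℕ → Bool) → Bool
  any6 f = f 1 ∨ (f 2 ∨ (f 3 ∨ (f 4 ∨ (f 5 ∨ f 6))))

  sum6 : (ℕ → ℕ) → ℕ
  sum6 f = f 6 + (f 5 + (f 4 + (f 3 + (f 2 + (f 1 + 0)))))

  -- For a letter of value e at position k, lookback w s is the letter at position k - s, and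
  -- P (k - s) compares with P k as val (lookback w s) with s + e. The checks say that P (k - s) ≠ P k,
  -- that e + 2 (number of earlier vertices above P k) = 6, and that the value k - 3 is attained.
  -- A window at position k is cut when no earlier vertex has value at least k, and final when,
  -- moreover, the values k - 3, k - 2 and k - 1 are attained.
  injectiveAt degreeAt surjectiveAt : Window → ℕ → Bool
  injectiveAt w e = all6 (λ s → not (val (lookback w s) ≡ᵇ (s + e)))
  degreeAt w e = (e + 2 * sum6 (λ s → indicator ((s + e) <ᵇ val (lookback w s)))) ≡ᵇ 6
  surjectiveAt w e = (e ≡ᵇ 0) ∨ any6 (λ s → val (lookback w s) ≡ᵇ s)

  consistent : Window → Letter → Bool
  consistent w l = injectiveAt w (val l) ∧ (degreeAt w (val l) ∧ surjectiveAt w (val l))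

  isCut : Window → Bool
  isCut w = not (any6 (λ s → (s + 2) <ᵇ val (lookback w s)))

  attains : Window → ℕ → Bool
  attains w c = any6 (λ s → val (lookback w s) ≡ᵇ (s + c))

  isFinal : Window → Bool
  isFinal w = isCut w ∧ (attains w 0 ∧ (attains w 1 ∧ attains w 2))

  continues ends : Window → Letter → Bool
  continues w l = consistent w l ∧ not (isCut (push w l))
  ends w l = consistent w l ∧ isFinal (push w l)

  open Parsing _≟ₗ_ letters ∈-letters push continues ends public

module WordShapes where

  open Words

  -- The rest of a boxcar word after a block; its first car is entered at vertex b or at vertex c₁.
  data Tail : Set where
    fromB fromC : Tail

  block : Tail → Car → List Letter
  block fromB car2 = a6 ∷ a4 ∷ a0 ∷ a6 ∷ a0 ∷ []
  block fromB car3 = a6 ∷ a6 ∷ a0 ∷ a6 ∷ a0 ∷ a0 ∷ []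
  block fromC car2 = a6 ∷ a2 ∷ a0 ∷ []
  block fromC car3 = a6 ∷ a6 ∷ a0 ∷ a0 ∷ a6 ∷ a0 ∷ []

  after : Tail → Car → Tail
  after fromB car2 = fromC
  after fromC car2 = fromB
  after f car3 = f

  final : Tail → List Letter
  final fromB = a6 ∷ a6 ∷ a0 ∷ a2 ∷ a0 ∷ []
  final fromC = a6 ∷ a4 ∷ a0 ∷ a0 ∷ []

  tailWord : Tail → List Car → List Letter
  tailWord f [] = final f
  tailWord f (c ∷ cs) = block f c ++ tailWord (after f c) cs

  -- The windows in which a tail word can begin, found by exploring the automaton; covers-entries shows that the list is closed.
  entries : Tail → List Window
  entries fromB = (a0 ∷ a0 ∷ a6 ∷ a4 ∷ a6 ∷ a3 ∷ []) ∷ (a0 ∷ a0 ∷ a6 ∷ a0 ∷ a6 ∷ a6 ∷ []) ∷ (a0 ∷ a2 ∷ a6 ∷ a0 ∷ a6 ∷ a0 ∷ []) ∷ []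
  entries fromC = (a0 ∷ a6 ∷ a0 ∷ a4 ∷ a6 ∷ a0 ∷ []) ∷ (a0 ∷ a6 ∷ a0 ∷ a0 ∷ a6 ∷ a6 ∷ []) ∷ []

  isEntry : Tail → Window → Bool
  isEntry f w = ⌊ member? (Vec.≡-dec _≟ₗ_) w (entries f) ⌋

  isEntry⇒∈ : ∀ f w → T (isEntry f w) → w ∈ entries f
  isEntry⇒∈ f w = toWitness

  tailPattern : Tail → Pattern
  tailPattern f = (final f , stop)
    ∷ (block f car2 , continueIf (isEntry (after f car2)))
    ∷ (block f car3 , continueIf (isEntry (after f car3))) ∷ []

  covers-entries : ∀ f → All (λ w → T (Covers 6 w (tailPattern f))) (entries f)
  covers-entries fromB = _ ∷ _ ∷ _ ∷ []
  covers-entries fromC = _ ∷ _ ∷ []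

  block-nonempty : ∀ f c → 1 ≤ length (block f c)
  block-nonempty fromB car2 = s≤s z≤n
  block-nonempty fromB car3 = s≤s z≤n
  block-nonempty fromC car2 = s≤s z≤n
  block-nonempty fromC car3 = s≤s z≤n

  TailOf : Tail → List Letter → Set
  TailOf f ls = Σ (List Car) λ cs → ls ≡ tailWord f cs

  shorter-after-block : ∀ f c {n} v → length (block f c ++ v) ≤ suc n → length v ≤ n
  shorter-after-block f c v bound =
    ≤-pred (≤-trans (+-monoˡ-≤ (length v) (block-nonempty f c)) (subst (_≤ _) (length-++ (block f c)) bound))

  mutual
    accepted-tail : ∀ n f {w ls} → length ls ≤ n → w ∈ entries f → Accepts w ls → TailOf f ls
    accepted-tail n f bound w∈ acc = tail-of-parse n f bound (parse 6 (lookupAll (covers-entries f) w∈) acc)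

    tail-of-parse : ∀ n f {w ls} → length ls ≤ n → Parse w (tailPattern f) ls → TailOf f ls
    tail-of-parse n f bound (stopped (here refl)) = [] , refl
    tail-of-parse n f bound (stopped (there (here ())))
    tail-of-parse n f bound (stopped (there (there (here ()))))
    tail-of-parse n f bound (stopped (there (there (there ()))))
    tail-of-parse n f bound (continued (here ()) _ _)
    tail-of-parse n f bound (continued (there (here refl)) t acc) = accepted-block n f car2 bound t acc
    tail-of-parse n f bound (continued (there (there (here refl))) t acc) = accepted-block n f car3 bound t acc
    tail-of-parse n f bound (continued (there (there (there ()))) _ _)

    accepted-block : ∀ n f c {w v} → length (block f c ++ v) ≤ n →
      T (isEntry (after f c) (run w (block f c))) → Accepts (run w (block f c)) v → TailOf f (block f c ++ v)
    accepted-block zero f c {v = v} bound _ _ =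
      contradiction (≤-trans (block-nonempty f c) (≤-trans (m≤m+n _ (length v)) (subst (_≤ 0) (length-++ (block f c)) bound))) λ ()
    accepted-block (suc n) f c {v = v} bound t acc =
      Data.Product.map (c ∷_) (cong (block f c ++_)) (accepted-tail n (after f c) (shorter-after-block f c v bound) (isEntry⇒∈ (after f c) _ t) acc)

  k4Word k33Word headWord : List Letter
  k4Word = a6 ∷ a4 ∷ a2 ∷ a0 ∷ []
  k33Word = a6 ∷ a6 ∷ a6 ∷ a0 ∷ a0 ∷ a0 ∷ []
  headWord = a6 ∷ a4 ∷ a6 ∷ a0 ∷ a0 ∷ []

  data Shape : List Letter → Set where
    shape-K4 : Shape k4Word
    shape-K33 : Shape k33Word
    shape-boxcar : ∀ cs → Shape (headWord ++ tailWord fromB cs)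
    shape-transposable : ∀ w → Shape (a6 ∷ a6 ∷ a2 ∷ a0 ∷ w)

  startPattern : Pattern
  startPattern = (k4Word , stop) ∷ (k33Word , stop) ∷ (headWord , continueIf (isEntry fromB))
    ∷ (a6 ∷ a6 ∷ a2 ∷ a0 ∷ [] , continueIf (const true)) ∷ []

  shape-of-parse : ∀ {ls} → Parse blankWindow startPattern ls → Shape ls
  shape-of-parse (stopped (here refl)) = shape-K4
  shape-of-parse (stopped (there (here refl))) = shape-K33
  shape-of-parse (stopped (there (there (here ()))))
  shape-of-parse (stopped (there (there (there (here ())))))
  shape-of-parse (stopped (there (there (there (there ())))))
  shape-of-parse (continued (here ()) _ _)
  shape-of-parse (continued (there (here ())) _ _)
  shape-of-parse (continued (there (there (here refl))) t acc) = boxcar-shape (accepted-tail _ fromB ≤-refl (isEntry⇒∈ fromB _ t) acc)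
    where
    boxcar-shape : ∀ {v} → TailOf fromB v → Shape (headWord ++ v)
    boxcar-shape (cs , refl) = shape-boxcar cs
  shape-of-parse (continued (there (there (there (here refl)))) _ _) = shape-transposable _
  shape-of-parse (continued (there (there (there (there ())))) _ _)

  covers-start : T (Covers 6 blankWindow startPattern)
  covers-start = _

  shape : ∀ {ls} → Accepts blankWindow ls → Shape ls
  shape acc = shape-of-parse (parse 6 covers-start acc)

module WordGraph where

  open import Data.List using (take; drop)
  open import Data.List.Properties using (map-++; take++drop≡id; ++-assoc)
  open Words
  open EdgeLists
  open BlockMaps

  edgesFrom : ℕ → ℕ → ℕ → List Letter → Edges
  edgesFrom zero ev g xs = []
  edgesFrom (suc f) ev g [] = []
  edgesFrom (suc f) ev g (x ∷ xs) = if (g + val x) <ᵇ ev then (0 , g) ∷ edgesFrom f ev (suc g) xs else edgesFrom f ev (suc g) xs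

  wordEdges : List Letter → Edges
  wordEdges [] = []
  wordEdges (x ∷ xs) = edgesFrom 5 (val x) 1 xs ++ shiftEdges 1 (wordEdges xs)

  edgesLeaving : List Letter → List Letter → Edges
  edgesLeaving [] t = []
  edgesLeaving (x ∷ xs) t = edgesFrom 5 (val x) 1 (xs ++ t) ++ shiftEdges 1 (edgesLeaving xs t)

  shiftEdges-0 : ∀ A → shiftEdges 0 A ≡ A
  shiftEdges-0 [] = refl
  shiftEdges-0 ((a , b) ∷ A) = cong ((a , b) ∷_) (shiftEdges-0 A)

  wordEdges-++ : ∀ u v → wordEdges (u ++ v) ≡ edgesLeaving u v ++ shiftEdges (length u) (wordEdges v)
  wordEdges-++ [] v = sym (shiftEdges-0 (wordEdges v))
  wordEdges-++ (x ∷ u) v = trans (cong (λ z → edgesFrom 5 (val x) 1 (u ++ v) ++ shiftEdges 1 z) (wordEdges-++ u v))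
    (trans (cong (edgesFrom 5 (val x) 1 (u ++ v) ++_) (trans (shiftEdges-++ 1 (edgesLeaving u v) _) (cong (shiftEdges 1 (edgesLeaving u v) ++_) (shiftEdges-+ 1 (length u) (wordEdges v)))))
      (sym (++-assoc (edgesFrom 5 (val x) 1 (u ++ v)) (shiftEdges 1 (edgesLeaving u v)) _)))

  map-blockMap-shift : ∀ lp F Z → map (mapPair (blockMap lp F)) (shiftEdges (length lp) Z) ≡ shiftEdges (length lp) (map (mapPair F) Z)
  map-blockMap-shift lp F [] = refl
  map-blockMap-shift lp F ((a , b) ∷ Z) = cong₂ _∷_ (cong₂ _,_ (blockMap-+ lp F a) (blockMap-+ lp F b)) (map-blockMap-shift lp F Z)

  relabelled-wordEdges-++ : ∀ (B : List Letter) (lp : List ℕ) (F : ℕ → ℕ) (v : List Letter) (off sz off' k' : ℕ) (X R : Edges) →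
    length B ≡ length lp → off + length lp ≡ sz + off' →
    SameEdges (shiftEdges off (map (mapPair (blockMap lp F)) (edgesLeaving B v))) (X ++ shiftEdges sz (take k' R)) →
    SameEdges (shiftEdges off' (map (mapPair F) (wordEdges v))) (drop k' R) →
    SameEdges (shiftEdges off (map (mapPair (blockMap lp F)) (wordEdges (B ++ v)))) (X ++ shiftEdges sz R)
  relabelled-wordEdges-++ B lp F v off sz off' k' X R eB ar chk ih =
    SameEdges-trans (≡⇒SameEdges lhs) (SameEdges-trans (SameEdges-++ chk (SameEdges-shift sz ih)) (≡⇒SameEdges rhs))
    where
    lhs : shiftEdges off (map (mapPair (blockMap lp F)) (wordEdges (B ++ v))) ≡ shiftEdges off (map (mapPair (blockMap lp F)) (edgesLeaving B v)) ++ shiftEdges sz (shiftEdges off' (map (mapPair F) (wordEdges v)))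
    lhs = trans (cong (λ z → shiftEdges off (map (mapPair (blockMap lp F)) z)) (trans (wordEdges-++ B v) (cong (λ n → edgesLeaving B v ++ shiftEdges n (wordEdges v)) eB)))
          (trans (cong (shiftEdges off) (trans (map-++ (mapPair (blockMap lp F)) (edgesLeaving B v) _) (cong (map (mapPair (blockMap lp F)) (edgesLeaving B v) ++_) (map-blockMap-shift lp F (wordEdges v)))))
          (trans (shiftEdges-++ off (map (mapPair (blockMap lp F)) (edgesLeaving B v)) (shiftEdges (length lp) (map (mapPair F) (wordEdges v)))) (cong (shiftEdges off (map (mapPair (blockMap lp F)) (edgesLeaving B v)) ++_)
            (trans (shiftEdges-+ off (length lp) _) (trans (cong (λ n → shiftEdges n (map (mapPair F) (wordEdges v))) ar) (sym (shiftEdges-+ sz off' _)))))))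
    rhs : (X ++ shiftEdges sz (take k' R)) ++ shiftEdges sz (drop k' R) ≡ X ++ shiftEdges sz R
    rhs = trans (++-assoc X _ _) (cong (X ++_) (trans (sym (shiftEdges-++ sz (take k' R) (drop k' R))) (cong (shiftEdges sz) (take++drop≡id k' R))))

module WordAdjacency where

  open import Data.Nat.Properties using (+-suc; +-identityʳ)
  open import Data.Bool.Properties using (∨-assoc)
  open Words
  open EdgeLists
  open WordGraph

  nth : List Letter → ℕ → Letter
  nth [] k = a3
  nth (x ∷ xs) zero = x
  nth (x ∷ xs) (suc k) = nth xs k

  dir : List Letter → ℕ → ℕ → Bool
  dir w a b = (a <ᵇ b) ∧ ((b <ᵇ length w) ∧ (((b ∸ a) + val (nth w b)) <ᵇ val (nth w a)))

  wordAdj : List Letter → ℕ → ℕ → Bool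
  wordAdj w a b = dir w a b ∨ dir w b a

  arc : ℕ → ℕ → ℕ × ℕ → Bool
  arc u v (a , b) = (a ≡ᵇ u) ∧ (b ≡ᵇ v)

  arcAdj : Edges → ℕ → ℕ → Bool
  arcAdj [] u v = false
  arcAdj (x ∷ xs) u v = arc u v x ∨ arcAdj xs u v

  swap4 : ∀ p q r s → (p ∨ q) ∨ (r ∨ s) ≡ (p ∨ r) ∨ (q ∨ s)
  swap4 true q r s = refl
  swap4 false true true s = refl
  swap4 false false true s = refl
  swap4 false true false s = refl
  swap4 false false false s = refl

  edgeAdj-arcs : ∀ A u v → edgeAdj A u v ≡ arcAdj A u v ∨ arcAdj A v u
  edgeAdj-arcs [] u v = refl
  edgeAdj-arcs ((a , b) ∷ A) u v = trans (cong (joins u v (a , b) ∨_) (edgeAdj-arcs A u v)) (swap4 (arc u v (a , b)) (arc v u (a , b)) _ _)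

  arcAdj-++ : ∀ A B u v → arcAdj (A ++ B) u v ≡ arcAdj A u v ∨ arcAdj B u v
  arcAdj-++ [] B u v = refl
  arcAdj-++ (x ∷ A) B u v = trans (cong (arc u v x ∨_) (arcAdj-++ A B u v)) (sym (∨-assoc (arc u v x) _ _))

  arcAdj-shift-from0 : ∀ A v → arcAdj (shiftEdges 1 A) 0 v ≡ false
  arcAdj-shift-from0 [] v = refl
  arcAdj-shift-from0 ((a , b) ∷ A) v = arcAdj-shift-from0 A v

  arcAdj-shift-to0 : ∀ A u → arcAdj (shiftEdges 1 A) u 0 ≡ false
  arcAdj-shift-to0 [] u = refl
  arcAdj-shift-to0 ((a , b) ∷ A) u with (suc a ≡ᵇ u)
  ... | true = arcAdj-shift-to0 A u
  ... | false = arcAdj-shift-to0 A u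

  arcAdj-shift : ∀ A u v → arcAdj (shiftEdges 1 A) (suc u) (suc v) ≡ arcAdj A u v
  arcAdj-shift [] u v = refl
  arcAdj-shift ((a , b) ∷ A) u v = cong (arc u v (a , b) ∨_) (arcAdj-shift A u v)

  emit-suc : ∀ f ev g xs u v → arcAdj (edgesFrom f ev g xs) (suc u) v ≡ false
  emit-suc zero ev g xs u v = refl
  emit-suc (suc f) ev g [] u v = refl
  emit-suc (suc f) ev g (x ∷ xs) u v with (g + val x) <ᵇ ev
  ... | true = emit-suc f ev (suc g) xs u v
  ... | false = emit-suc f ev (suc g) xs u v

  emit-lo : ∀ f ev g xs b → b < g → arcAdj (edgesFrom f ev g xs) 0 b ≡ false
  emit-lo zero ev g xs b p = refl
  emit-lo (suc f) ev g [] b p = refl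
  emit-lo (suc f) ev g (x ∷ xs) b p with (g + val x) <ᵇ ev
  ... | true = trans (cong (_∨ arcAdj (edgesFrom f ev (suc g) xs) 0 b) (≡ᵇ-lo' g b p)) (emit-lo f ev (suc g) xs b (≤s p))
    where
    ≡ᵇ-lo' : ∀ g b → b < g → (true ∧ (g ≡ᵇ b)) ≡ false
    ≡ᵇ-lo' (suc g) zero p = refl
    ≡ᵇ-lo' (suc g) (suc b) (s≤s p) = ≡ᵇ-lo' g b p
    ≤s : ∀ {b g} → b < g → b < suc g
    ≤s {zero} p = s≤s z≤n
    ≤s {suc b} {suc g} (s≤s p) = s≤s (≤s p)
  ... | false = emit-lo f ev (suc g) xs b (≤s' p)
    where
    ≤s' : ∀ {b g} → b < g → b < suc g
    ≤s' {zero} p = s≤s z≤n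
    ≤s' {suc b} {suc g} (s≤s p) = s≤s (≤s' p)

  ≡ᵇ-refl : ∀ g → (g ≡ᵇ g) ≡ true
  ≡ᵇ-refl zero = refl
  ≡ᵇ-refl (suc g) = ≡ᵇ-refl g

  ≡ᵇ-suc : ∀ g m → (g ≡ᵇ (g + suc m)) ≡ false
  ≡ᵇ-suc zero m = refl
  ≡ᵇ-suc (suc g) m = ≡ᵇ-suc g m

  ∨f : ∀ x → (x ∨ false) ≡ x
  ∨f true = refl
  ∨f false = refl

  emit-at : ∀ f ev g xs m → arcAdj (edgesFrom f ev g xs) 0 (g + m) ≡ ((m <ᵇ f) ∧ ((m <ᵇ length xs) ∧ (((g + m) + val (nth xs m)) <ᵇ ev)))
  emit-at zero ev g xs m = refl
  emit-at (suc f) ev g [] zero = refl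
  emit-at (suc f) ev g [] (suc m) = sym (∧f (m <ᵇ f))
  emit-at (suc f) ev g (x ∷ xs) zero rewrite +-identityʳ g with (g + val x) <ᵇ ev
  ... | true = cong (λ z → (true ∧ z) ∨ arcAdj (edgesFrom f ev (suc g) xs) 0 g) (≡ᵇ-refl g)
  ... | false = emit-lo f ev (suc g) xs g (s≤s ≤r)
    where
    ≤r : ∀ {g} → g ≤ g
    ≤r {zero} = z≤n
    ≤r {suc g} = s≤s ≤r
  emit-at (suc f) ev g (x ∷ xs) (suc m) with (g + val x) <ᵇ ev
  ... | true = trans (cong (λ z → (true ∧ z) ∨ arcAdj (edgesFrom f ev (suc g) xs) 0 (g + suc m)) (≡ᵇ-suc g m))
                   (trans (cong (arcAdj (edgesFrom f ev (suc g) xs) 0) (+-suc g m)) (trans (emit-at f ev (suc g) xs m) (cong (λ z → (m <ᵇ f) ∧ ((m <ᵇ length xs) ∧ ((z + val (nth xs m)) <ᵇ ev))) (sym (+-suc g m)))))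
  ... | false = trans (cong (arcAdj (edgesFrom f ev (suc g) xs) 0) (+-suc g m)) (trans (emit-at f ev (suc g) xs m) (cong (λ z → (m <ᵇ f) ∧ ((m <ᵇ length xs) ∧ ((z + val (nth xs m)) <ᵇ ev))) (sym (+-suc g m))))

  -- The fuel bound m < 5 is implied by the value test, since letters are at most 6.
  big : ∀ k y x → (((6 + k) + val y) <ᵇ val x) ≡ false
  big k y a0 = refl
  big k y a2 = refl
  big k y a3 = refl
  big k y a4 = refl
  big k y a6 = refl

  fuel5 : ∀ m c y x → ((m <ᵇ 5) ∧ (c ∧ ((suc m + val y) <ᵇ val x))) ≡ (c ∧ ((suc m + val y) <ᵇ val x))
  fuel5 0 c y x = refl
  fuel5 1 c y x = refl
  fuel5 2 c y x = refl
  fuel5 3 c y x = refl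
  fuel5 4 c y x = refl
  fuel5 (suc (suc (suc (suc (suc k))))) c y x = sym (trans (cong (c ∧_) (big k y x)) (∧f c))

  arcAdj-wordEdges : ∀ w a b → arcAdj (wordEdges w) a b ≡ dir w a b
  arcAdj-wordEdges [] a b = sym (∧f (a <ᵇ b))
  arcAdj-wordEdges (x ∷ xs) a b = trans (arcAdj-++ (edgesFrom 5 (val x) 1 xs) (shiftEdges 1 (wordEdges xs)) a b) (go a b)
    where
    go : ∀ a b → (arcAdj (edgesFrom 5 (val x) 1 xs) a b ∨ arcAdj (shiftEdges 1 (wordEdges xs)) a b) ≡ dir (x ∷ xs) a b
    go zero zero = cong₂ _∨_ (emit-lo 5 (val x) 1 xs 0 (s≤s z≤n)) (arcAdj-shift-from0 (wordEdges xs) 0)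
    go zero (suc m) = trans (cong₂ _∨_ (emit-at 5 (val x) 1 xs m) (arcAdj-shift-from0 (wordEdges xs) (suc m)))
                       (trans (∨f _) (fuel5 m (m <ᵇ length xs) (nth xs m) x))
    go (suc u) zero = cong₂ _∨_ (emit-suc 5 (val x) 1 xs u 0) (arcAdj-shift-to0 (wordEdges xs) (suc u))
    go (suc u) (suc v) = trans (cong₂ _∨_ (emit-suc 5 (val x) 1 xs u (suc v)) (arcAdj-shift (wordEdges xs) u v)) (arcAdj-wordEdges xs u v)

  wordEdges-adj : ∀ w a b → edgeAdj (wordEdges w) a b ≡ wordAdj w a b
  wordEdges-adj w a b = trans (edgeAdj-arcs (wordEdges w) a b) (cong₂ _∨_ (arcAdj-wordEdges w a b) (arcAdj-wordEdges w b a))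

module BoxcarWords where

  open import Data.Nat.Properties using (+-identityʳ; +-assoc)
  open import Data.List using (take; drop)
  open import Data.Unit using (tt)
  open Words
  open WordShapes
  open EdgeLists
  open BlockMaps
  open WordGraph

  carSize : Car → ℕ
  carSize car2 = 4
  carSize car3 = 6

  carEdges : Car → ℕ → Edges
  carEdges car2 = g2Edges
  carEdges car3 = g3Edges

  g4Edges-shift : ∀ r → g4Edges r ≡ shiftEdges r (g4Edges 0)
  g4Edges-shift r rewrite +-identityʳ r = refl

  carEdges-shift : ∀ c r → carEdges c r ≡ shiftEdges r (carEdges c 0)
  carEdges-shift car2 r rewrite +-identityʳ r = refl
  carEdges-shift car3 r rewrite +-identityʳ r = refl

  rightEnd-∷ : ∀ r c cs → rightEnd r (c ∷ cs) ≡ rightEnd (r + carSize c) cs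
  rightEnd-∷ r car2 cs = refl
  rightEnd-∷ r car3 cs = refl

  rightEnd-shift : ∀ a r cs → rightEnd (a + r) cs ≡ a + rightEnd r cs
  rightEnd-shift a r [] = refl
  rightEnd-shift a r (c ∷ cs) = trans (rightEnd-∷ (a + r) c cs) (trans (cong (λ z → rightEnd z cs) (+-assoc a r (carSize c)))
    (trans (rightEnd-shift a (r + carSize c) cs) (cong (a +_) (sym (rightEnd-∷ r c cs)))))

  carsEdges-∷ : ∀ r c cs → carsEdges r (c ∷ cs) ≡ carEdges c r ++ carsEdges (r + carSize c) cs
  carsEdges-∷ r car2 cs = refl
  carsEdges-∷ r car3 cs = refl

  carsEdges-shift : ∀ r cs → carsEdges r cs ≡ shiftEdges r (carsEdges 0 cs)
  carsEdges-shift r [] = g4Edges-shift r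
  carsEdges-shift r (c ∷ cs) = begin
    carsEdges r (c ∷ cs)                                        ≡⟨ carsEdges-∷ r c cs ⟩
    carEdges c r ++ carsEdges (r + carSize c) cs                ≡⟨ cong₂ _++_ (carEdges-shift c r) (carsEdges-shift (r + carSize c) cs) ⟩
    shiftEdges r (carEdges c 0) ++ shiftEdges (r + carSize c) (carsEdges 0 cs)  ≡⟨ cong (shiftEdges r (carEdges c 0) ++_) (sym (trans (cong (shiftEdges r) (carsEdges-shift (carSize c) cs)) (shiftEdges-+ r (carSize c) _))) ⟩
    shiftEdges r (carEdges c 0) ++ shiftEdges r (carsEdges (carSize c) cs)      ≡⟨ sym (shiftEdges-++ r (carEdges c 0) _) ⟩
    shiftEdges r (carEdges c 0 ++ carsEdges (carSize c) cs)         ≡⟨ cong (shiftEdges r) (sym (carsEdges-∷ 0 c cs)) ⟩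
    shiftEdges r (carsEdges 0 (c ∷ cs))                             ∎

  -- A tail word numbers its first car from vertex offset f; the first skipped f edges of that car belong to the preceding block.
  offset skipped : Tail → ℕ
  offset fromB = 1
  offset fromC = 2
  skipped fromB = 1
  skipped fromC = 3

  block-span : ∀ f c → offset f + length (block f c) ≡ carSize c + offset (after f c)
  block-span fromB car2 = refl
  block-span fromB car3 = refl
  block-span fromC car2 = refl
  block-span fromC car3 = refl

  blockOrder blockOrder⁻¹ : Tail → Car → List ℕ
  blockOrder fromB car2 = 1 ∷ 2 ∷ 0 ∷ 4 ∷ 3 ∷ []
  blockOrder fromB car3 = 1 ∷ 2 ∷ 0 ∷ 5 ∷ 3 ∷ 4 ∷ []
  blockOrder fromC car2 = 2 ∷ 0 ∷ 1 ∷ []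
  blockOrder fromC car3 = 2 ∷ 3 ∷ 0 ∷ 1 ∷ 5 ∷ 4 ∷ []
  blockOrder⁻¹ fromB car2 = 2 ∷ 0 ∷ 1 ∷ 4 ∷ 3 ∷ []
  blockOrder⁻¹ fromB car3 = 2 ∷ 0 ∷ 1 ∷ 4 ∷ 5 ∷ 3 ∷ []
  blockOrder⁻¹ fromC car2 = 1 ∷ 2 ∷ 0 ∷ []
  blockOrder⁻¹ fromC car3 = 2 ∷ 3 ∷ 0 ∷ 1 ∷ 5 ∷ 4 ∷ []

  finalOrder finalOrder⁻¹ : Tail → List ℕ
  finalOrder fromB = 1 ∷ 2 ∷ 0 ∷ 3 ∷ 4 ∷ []
  finalOrder fromC = 2 ∷ 3 ∷ 0 ∷ 1 ∷ []
  finalOrder⁻¹ fromB = 2 ∷ 0 ∷ 1 ∷ 3 ∷ 4 ∷ []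
  finalOrder⁻¹ fromC = 2 ∷ 3 ∷ 0 ∷ 1 ∷ []

  block-bijection : ∀ f c → BlockBijection (length (block f c)) (blockOrder f c) (blockOrder⁻¹ f c)
  block-bijection fromB car2 = record { length-ps = refl ; length-qs = refl ; ps∘qs = _ ; qs∘ps = _ }
  block-bijection fromB car3 = record { length-ps = refl ; length-qs = refl ; ps∘qs = _ ; qs∘ps = _ }
  block-bijection fromC car2 = record { length-ps = refl ; length-qs = refl ; ps∘qs = _ ; qs∘ps = _ }
  block-bijection fromC car3 = record { length-ps = refl ; length-qs = refl ; ps∘qs = _ ; qs∘ps = _ }

  final-bijection : ∀ f → BlockBijection (length (final f)) (finalOrder f) (finalOrder⁻¹ f)
  final-bijection fromB = record { length-ps = refl ; length-qs = refl ; ps∘qs = _ ; qs∘ps = _ }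
  final-bijection fromC = record { length-ps = refl ; length-qs = refl ; ps∘qs = _ ; qs∘ps = _ }

  relabel unlabel : Tail → List Car → ℕ → ℕ
  relabel f [] = blockMap (finalOrder f) id
  relabel f (c ∷ cs) = blockMap (blockOrder f c) (relabel (after f c) cs)
  unlabel f [] = blockMap (finalOrder⁻¹ f) id
  unlabel f (c ∷ cs) = blockMap (blockOrder⁻¹ f c) (unlabel (after f c) cs)

  relabel-unlabel : ∀ f cs y → relabel f cs (unlabel f cs y) ≡ y
  relabel-unlabel f [] = blockMap-inverse (final-bijection f) (λ _ → refl)
  relabel-unlabel f (c ∷ cs) = blockMap-inverse (block-bijection f c) (relabel-unlabel (after f c) cs)

  unlabel-relabel : ∀ f cs x → unlabel f cs (relabel f cs x) ≡ x
  unlabel-relabel f [] = blockMap-inverse (BlockBijection-sym (final-bijection f)) (λ _ → refl)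
  unlabel-relabel f (c ∷ cs) = blockMap-inverse (BlockBijection-sym (block-bijection f c)) (unlabel-relabel (after f c) cs)

  module _ (label : Tail → List Car → ℕ → ℕ)
    (final-bounded : ∀ f x → x < length (final f) → label f [] x < length (final f))
    (step-bounded : ∀ f c cs → (∀ y → y < length (tailWord (after f c) cs) → label (after f c) cs y < length (tailWord (after f c) cs))
       → ∀ x → x < length (block f c) + length (tailWord (after f c) cs) → label f (c ∷ cs) x < length (block f c) + length (tailWord (after f c) cs)) where

    tail-bounded : ∀ f cs x → x < length (tailWord f cs) → label f cs x < length (tailWord f cs)
    tail-bounded f [] = final-bounded f
    tail-bounded f (c ∷ cs) x x< = subst (label f (c ∷ cs) x <_) (sym len)
      (step-bounded f c cs (tail-bounded (after f c) cs) x (subst (x <_) len x<))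
      where
      len : length (tailWord f (c ∷ cs)) ≡ length (block f c) + length (tailWord (after f c) cs)
      len = length-++ (block f c)

  relabel-bounded : ∀ f cs x → x < length (tailWord f cs) → relabel f cs x < length (tailWord f cs)
  relabel-bounded = tail-bounded relabel
    (λ f x x< → subst (blockMap (finalOrder f) id x <_) (+-identityʳ _) (blockMap-bounded (final-bijection f) (λ _ p → p) x (subst (x <_) (sym (+-identityʳ _)) x<)))
    (λ f c _ → blockMap-bounded (block-bijection f c))
  unlabel-bounded : ∀ f cs x → x < length (tailWord f cs) → unlabel f cs x < length (tailWord f cs)
  unlabel-bounded = tail-bounded unlabel
    (λ f x x< → subst (blockMap (finalOrder⁻¹ f) id x <_) (+-identityʳ _) (blockMap-bounded (BlockBijection-sym (final-bijection f)) (λ _ p → p) x (subst (x <_) (sym (+-identityʳ _)) x<)))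
    (λ f c _ → blockMap-bounded (BlockBijection-sym (block-bijection f c)))

  tailWord-length : ∀ f cs → offset f + length (tailWord f cs) ≡ rightEnd 0 cs + 6
  tailWord-length fromB [] = refl
  tailWord-length fromC [] = refl
  tailWord-length f (c ∷ cs) = begin
    offset f + length (block f c ++ tailWord (after f c) cs)            ≡⟨ cong (offset f +_) (length-++ (block f c)) ⟩
    offset f + (length (block f c) + length (tailWord (after f c) cs))  ≡⟨ sym (+-assoc (offset f) _ _) ⟩
    offset f + length (block f c) + length (tailWord (after f c) cs)    ≡⟨ cong (_+ length (tailWord (after f c) cs)) (block-span f c) ⟩
    carSize c + offset (after f c) + length (tailWord (after f c) cs)   ≡⟨ +-assoc (carSize c) _ _ ⟩
    carSize c + (offset (after f c) + length (tailWord (after f c) cs)) ≡⟨ cong (carSize c +_) (tailWord-length (after f c) cs) ⟩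
    carSize c + (rightEnd 0 cs + 6)                                     ≡⟨ sym (+-assoc (carSize c) _ 6) ⟩
    carSize c + rightEnd 0 cs + 6                                       ≡⟨ cong (_+ 6) (sym (rightEnd-shift (carSize c) 0 cs)) ⟩
    rightEnd (carSize c + 0) cs + 6                                     ≡⟨ cong (λ r → rightEnd r cs + 6) (+-identityʳ (carSize c)) ⟩
    rightEnd (carSize c) cs + 6                                         ≡⟨ cong (_+ 6) (sym (rightEnd-∷ 0 c cs)) ⟩
    rightEnd 0 (c ∷ cs) + 6                                             ∎

  -- A block's edges reach at most five letters into the following tail word, so two cars of lookahead suffice.
  block-edges : ∀ f c cs → SameEdges (shiftEdges (offset f) (map (mapPair (relabel f (c ∷ cs))) (edgesLeaving (block f c) (tailWord (after f c) cs))))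
                               (drop (skipped f) (carEdges c 0) ++ shiftEdges (carSize c) (take (skipped (after f c)) (carsEdges 0 cs)))
  block-edges fromB car2 [] = SameEdges-by-inclusion _ _ tt tt
  block-edges fromB car2 (car2 ∷ []) = SameEdges-by-inclusion _ _ tt tt
  block-edges fromB car2 (car2 ∷ car2 ∷ cs) = SameEdges-by-inclusion _ _ tt tt
  block-edges fromB car2 (car2 ∷ car3 ∷ cs) = SameEdges-by-inclusion _ _ tt tt
  block-edges fromB car2 (car3 ∷ cs) = SameEdges-by-inclusion _ _ tt tt
  block-edges fromB car3 [] = SameEdges-by-inclusion _ _ tt tt
  block-edges fromB car3 (car2 ∷ cs) = SameEdges-by-inclusion _ _ tt tt
  block-edges fromB car3 (car3 ∷ cs) = SameEdges-by-inclusion _ _ tt tt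
  block-edges fromC car2 [] = SameEdges-by-inclusion _ _ tt tt
  block-edges fromC car2 (car2 ∷ cs) = SameEdges-by-inclusion _ _ tt tt
  block-edges fromC car2 (car3 ∷ cs) = SameEdges-by-inclusion _ _ tt tt
  block-edges fromC car3 [] = SameEdges-by-inclusion _ _ tt tt
  block-edges fromC car3 (car2 ∷ []) = SameEdges-by-inclusion _ _ tt tt
  block-edges fromC car3 (car2 ∷ car2 ∷ cs) = SameEdges-by-inclusion _ _ tt tt
  block-edges fromC car3 (car2 ∷ car3 ∷ cs) = SameEdges-by-inclusion _ _ tt tt
  block-edges fromC car3 (car3 ∷ cs) = SameEdges-by-inclusion _ _ tt tt

  drop-carsEdges : ∀ f c cs → drop (skipped f) (carsEdges 0 (c ∷ cs)) ≡ drop (skipped f) (carEdges c 0) ++ carsEdges (carSize c) cs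
  drop-carsEdges fromB car2 cs = refl
  drop-carsEdges fromB car3 cs = refl
  drop-carsEdges fromC car2 cs = refl
  drop-carsEdges fromC car3 cs = refl

  tail-edges : ∀ f cs → SameEdges (shiftEdges (offset f) (map (mapPair (relabel f cs)) (wordEdges (tailWord f cs)))) (drop (skipped f) (carsEdges 0 cs))
  tail-edges fromB [] = SameEdges-by-inclusion _ _ tt tt
  tail-edges fromC [] = SameEdges-by-inclusion _ _ tt tt
  tail-edges f (c ∷ cs) = SameEdges-trans
    (relabelled-wordEdges-++ (block f c) (blockOrder f c) (relabel (after f c) cs) (tailWord (after f c) cs) (offset f) (carSize c) (offset (after f c)) (skipped (after f c))
           (drop (skipped f) (carEdges c 0)) (carsEdges 0 cs) (sym length-ps) (subst (λ m → offset f + m ≡ carSize c + offset (after f c)) (sym length-ps) (block-span f c))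
           (block-edges f c cs) (tail-edges (after f c) cs))
    (≡⇒SameEdges (sym (trans (drop-carsEdges f c cs) (cong (drop (skipped f) (carEdges c 0) ++_) (carsEdges-shift (carSize c) cs)))))
    where open BlockBijection (block-bijection f c)

  headOrder headOrder⁻¹ : List ℕ
  headOrder = 0 ∷ 1 ∷ 4 ∷ 2 ∷ 3 ∷ []
  headOrder⁻¹ = 0 ∷ 1 ∷ 3 ∷ 4 ∷ 2 ∷ []

  head-bijection : BlockBijection 5 headOrder headOrder⁻¹
  head-bijection = record { length-ps = refl ; length-qs = refl ; ps∘qs = _ ; qs∘ps = _ }

  relabelBoxcar unlabelBoxcar : List Car → ℕ → ℕ
  relabelBoxcar cs = blockMap headOrder (relabel fromB cs)
  unlabelBoxcar cs = blockMap headOrder⁻¹ (unlabel fromB cs)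

  relabelBoxcar-unlabel : ∀ cs y → relabelBoxcar cs (unlabelBoxcar cs y) ≡ y
  relabelBoxcar-unlabel cs = blockMap-inverse head-bijection (relabel-unlabel fromB cs)

  unlabelBoxcar-relabel : ∀ cs x → unlabelBoxcar cs (relabelBoxcar cs x) ≡ x
  unlabelBoxcar-relabel cs = blockMap-inverse (BlockBijection-sym head-bijection) (unlabel-relabel fromB cs)

  relabelBoxcar-bounded : ∀ cs x → x < length (headWord ++ tailWord fromB cs) → relabelBoxcar cs x < length (headWord ++ tailWord fromB cs)
  relabelBoxcar-bounded cs = blockMap-bounded head-bijection (relabel-bounded fromB cs)

  unlabelBoxcar-bounded : ∀ cs x → x < length (headWord ++ tailWord fromB cs) → unlabelBoxcar cs x < length (headWord ++ tailWord fromB cs)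
  unlabelBoxcar-bounded cs = blockMap-bounded (BlockBijection-sym head-bijection) (unlabel-bounded fromB cs)

  boxcarWord-length : ∀ cs → length (headWord ++ tailWord fromB cs) ≡ boxcarSize cs
  boxcarWord-length cs = trans (cong (4 +_) (tailWord-length fromB cs)) (trans (sym (+-assoc 4 _ 6)) (cong (_+ 6) (sym (rightEnd-shift 4 0 cs))))

  head-edges : ∀ cs → SameEdges (shiftEdges 0 (map (mapPair (relabelBoxcar cs)) (edgesLeaving headWord (tailWord fromB cs)))) (g1Edges ++ shiftEdges 4 (take 1 (carsEdges 0 cs)))
  head-edges [] = SameEdges-by-inclusion _ _ tt tt
  head-edges (car2 ∷ cs) = SameEdges-by-inclusion _ _ tt tt
  head-edges (car3 ∷ cs) = SameEdges-by-inclusion _ _ tt tt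

  boxcar-edges : ∀ cs → SameEdges (map (mapPair (relabelBoxcar cs)) (wordEdges (headWord ++ tailWord fromB cs))) (boxcarEdges cs)
  boxcar-edges cs = SameEdges-trans (SameEdges-sym (≡⇒SameEdges (shiftEdges-0 _)))
    (SameEdges-trans (relabelled-wordEdges-++ headWord headOrder (relabel fromB cs) (tailWord fromB cs) 0 4 1 1 g1Edges (carsEdges 0 cs) refl refl (head-edges cs) (tail-edges fromB cs))
               (≡⇒SameEdges (cong (g1Edges ++_) (sym (carsEdges-shift 4 cs)))))

Represents : ∀ {n} → Graph n → Permutation′ n → Permutation′ n → Set
Represents {n} G σ π = ∀ (i j : Fin n) → i <F j → ((G (σ ⟨$⟩ʳ i) (σ ⟨$⟩ʳ j) ≡ true) ⇔ (π ⟨$⟩ʳ j <F π ⟨$⟩ʳ i))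


Transposable : ∀ {n} → Permutation′ n → Set
Transposable {n} π = (3 < n) × (∀ i → toℕ i ≡ 1 → toℕ (π ⟨$⟩ʳ i) ≡ 4) × (∀ i → toℕ i ≡ 2 → toℕ (π ⟨$⟩ʳ i) ≡ 1)

module CubicPermutationGraph {n : ℕ} (G : Graph n) (σ π : Permutation′ n) (rep : Represents G σ π)
  (simp : IsSimple G) (reg : IsRegular 3 G) (conn : IsConnected G) where

  open import Data.Nat.Properties
  open import Data.Bool.Properties using (∨-identityʳ)
  open import Data.Fin.Properties using (toℕ-injective; toℕ-fromℕ<; toℕ<n)
  open import Data.Empty using (⊥)
  open import Function using (_∘_)
  open Words
  open BoolFacts
  open Sums
  open import Data.Nat.Tactic.RingSolver using (solve-∀)

  p : Fin n → ℕ
  p i = toℕ (π ⟨$⟩ʳ i)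

  P : ℕ → ℕ
  P = extendFin p

  fin : ∀ {x} → x < n → Fin n
  fin q = fromℕ< q

  P-fin : ∀ {x} (q : x < n) → P x ≡ p (fin q)
  P-fin {x} q = trans (cong P (sym (toℕ-fromℕ< q))) (extendFin-toℕ p (fin q))

  P<n : ∀ {x} → x < n → P x < n
  P<n q = subst (_< n) (sym (P-fin q)) (toℕ<n _)

  P-inj : ∀ {x y} → x < n → y < n → P x ≡ P y → x ≡ y
  P-inj {x} {y} qx qy e = trans (sym (toℕ-fromℕ< qx)) (trans (cong toℕ fe) (toℕ-fromℕ< qy))
    where
    e' : π ⟨$⟩ʳ fin qx ≡ π ⟨$⟩ʳ fin qy
    e' = toℕ-injective (trans (sym (P-fin qx)) (trans e (P-fin qy)))
    fe : fin qx ≡ fin qy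
    fe = trans (sym (inverseˡ π)) (trans (cong (π ⟨$⟩ˡ_) e') (inverseˡ π))

  P-surj : ∀ {v} → v < n → Σ ℕ λ x → (x < n) × (P x ≡ v)
  P-surj {v} q = toℕ j , toℕ<n j , trans (extendFin-toℕ p j) (trans (cong toℕ (inverseʳ π)) (toℕ-fromℕ< q))
    where
    j : Fin n
    j = π ⟨$⟩ˡ fin q

  P-toℕ : ∀ k → P (toℕ k) ≡ p k
  P-toℕ k = extendFin-toℕ p k

  inverted : ℕ → ℕ → Bool
  inverted x y = ((x <ᵇ y) ∧ (P y <ᵇ P x)) ∨ ((y <ᵇ x) ∧ (P x <ᵇ P y))

  G-inverted : ∀ i j → G (σ ⟨$⟩ʳ i) (σ ⟨$⟩ʳ j) ≡ inverted (toℕ i) (toℕ j)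
  G-inverted i j with <-cmp (toℕ i) (toℕ j)
  ... | tri< lt _ _ rewrite <ᵇ-true lt | <ᵇ-false {toℕ j} {toℕ i} (<⇒≤ lt) | P-toℕ i | P-toℕ j =
    trans (T-extensional (λ t → <⇒<ᵇ (Equivalence.to (rep i j lt) (T⇒≡ t))) (λ t → ≡⇒T (Equivalence.from (rep i j lt) (<ᵇ⇒< _ _ t)))) (sym (∨-identityʳ _))
  ... | tri> _ _ gt rewrite <ᵇ-true gt | <ᵇ-false {toℕ i} {toℕ j} (<⇒≤ gt) | P-toℕ i | P-toℕ j =
    trans (proj₁ simp (σ ⟨$⟩ʳ i) (σ ⟨$⟩ʳ j)) (T-extensional (λ t → <⇒<ᵇ (Equivalence.to (rep j i gt) (T⇒≡ t))) (λ t → ≡⇒T (Equivalence.from (rep j i gt) (<ᵇ⇒< _ _ t))))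
  ... | tri≈ _ e _ rewrite toℕ-injective e | <ᵇ-false {toℕ j} {toℕ j} ≤-refl = proj₂ simp (σ ⟨$⟩ʳ j)

  extendFin-fromℕ< : ∀ (g : Fin n → ℕ) {y} (q : y < n) → extendFin g y ≡ g (fin q)
  extendFin-fromℕ< g {y} q = trans (cong (extendFin g) (sym (toℕ-fromℕ< q))) (extendFin-toℕ g (fin q))

  sumBelow-extendFin : ∀ (f : ℕ → ℕ) → sumBelow (extendFin {n} (f ∘ toℕ)) n ≡ sumBelow f n
  sumBelow-extendFin f = sumBelow-cong (extendFin {n} (f ∘ toℕ)) f n (λ y q → trans (extendFin-fromℕ< (f ∘ toℕ) q) (cong f (toℕ-fromℕ< q)))

  inverted-count : ∀ {x} → x < n → sumBelow (λ y → indicator (inverted x y)) n ≡ 3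
  inverted-count {x} q = begin
    sumBelow row n                                         ≡⟨ sumBelow-extendFin row ⟨
    sumBelow (extendFin {n} (row ∘ toℕ)) n                 ≡⟨ ∑≡sumBelow {n} (row ∘ toℕ) ⟨
    ∑ {n} (row ∘ toℕ)                                 ≡⟨ ∑-cong {n} (λ j → cong indicator (G-row j)) ⟨
    ∑ (λ j → indicator (G (σ ⟨$⟩ʳ i) (σ ⟨$⟩ʳ j)))    ≡⟨ ∑-permute (λ u → indicator (G (σ ⟨$⟩ʳ i) u)) σ ⟨
    ∑ (λ u → indicator (G (σ ⟨$⟩ʳ i) u))              ≡⟨ degree≡∑ G (σ ⟨$⟩ʳ i) ⟨
    degree G (σ ⟨$⟩ʳ i)                                    ≡⟨ reg (σ ⟨$⟩ʳ i) ⟩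
    3                                                      ∎
    where
    i : Fin n
    i = fin q
    row : ℕ → ℕ
    row y = indicator (inverted x y)
    G-row : ∀ j → G (σ ⟨$⟩ʳ i) (σ ⟨$⟩ʳ j) ≡ inverted x (toℕ j)
    G-row j = trans (G-inverted i j) (cong (λ z → inverted z (toℕ j)) (toℕ-fromℕ< q))

  count-< : ∀ v m → v ≤ m → sumBelow (λ y → indicator (y <ᵇ v)) m ≡ v
  count-< v m q = trans (cong (sumBelow (λ y → indicator (y <ᵇ v))) (sym (m+[n∸m]≡n q)))
    (trans (sumBelow-+ₙ (λ y → indicator (y <ᵇ v)) v (m ∸ v)) (trans (cong₂ _+_ (trans (sumBelow-cong (λ y → indicator (y <ᵇ v)) (λ _ → 1) v (λ y r → cong indicator (<ᵇ-true r))) (sumBelow-1 v))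
      (trans (sumBelow-cong (λ y → indicator ((v + y) <ᵇ v)) (λ _ → 0) (m ∸ v) (λ y r → cong indicator (<ᵇ-false (m≤m+n v y)))) (sumBelow-0 (m ∸ v)))) (+-identityʳ v)))

  count-P< : ∀ v → v ≤ n → sumBelow (λ y → indicator (P y <ᵇ v)) n ≡ v
  count-P< v q = trans e1 (trans (sym (∑≡sumBelow {n} hp)) (trans (sym (∑-permute hu π)) (trans (∑≡sumBelow {n} hu) (trans (sumBelow-extendFin (λ y → indicator (y <ᵇ v))) (count-< v n q)))))
    where
    hp : Fin n → ℕ
    hp j = indicator (p j <ᵇ v)
    hu : Fin n → ℕ
    hu u = indicator (toℕ u <ᵇ v)
    e1 : sumBelow (λ y → indicator (P y <ᵇ v)) n ≡ sumBelow (extendFin {n} hp) n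
    e1 = sumBelow-cong (λ y → indicator (P y <ᵇ v)) (extendFin {n} hp) n (λ y r → sym (trans (extendFin-fromℕ< hp r) (cong (λ z → indicator (z <ᵇ v)) (sym (P-fin r)))))

  leftDegree leftBelow rightDegree : ℕ → ℕ
  leftDegree x = sumBelow (λ j → indicator (P x <ᵇ P j)) x
  leftBelow x = sumBelow (λ j → indicator (P j <ᵇ P x)) x
  rightDegree x = sumBelow (λ j → indicator (P (suc x + j) <ᵇ P x)) (n ∸ suc x)

  sumBelow-splitAt : ∀ f x → x < n → sumBelow f n ≡ sumBelow f x + (f x + sumBelow (λ j → f (suc x + j)) (n ∸ suc x))
  sumBelow-splitAt f x q = trans (cong (sumBelow f) (sym split-length)) (trans (sumBelow-+ₙ f x (suc (n ∸ suc x)))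
    (cong (sumBelow f x +_) (cong₂ _+_ (cong f (+-identityʳ x)) (sumBelow-cong _ _ (n ∸ suc x) (λ j _ → cong f (+-suc x j))))))
    where
    split-length : x + suc (n ∸ suc x) ≡ n
    split-length = trans (+-suc x (n ∸ suc x)) (m+[n∸m]≡n q)

  leftBelow+leftDegree : ∀ {x} → x < n → leftBelow x + leftDegree x ≡ x
  leftBelow+leftDegree {x} q = trans (sym (sumBelow-+ (λ j → indicator (P j <ᵇ P x)) (λ j → indicator (P x <ᵇ P j)) x))
    (trans (sumBelow-cong _ (λ _ → 1) x pointwise) (sumBelow-1 x))
    where
    pointwise : ∀ j → j < x → indicator (P j <ᵇ P x) + indicator (P x <ᵇ P j) ≡ 1
    pointwise j r with <-cmp (P j) (P x)
    ... | tri< a _ _ rewrite <ᵇ-true a | <ᵇ-false {P x} {P j} (<⇒≤ a) = refl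
    ... | tri> _ _ c rewrite <ᵇ-true c | <ᵇ-false {P j} {P x} (<⇒≤ c) = refl
    ... | tri≈ _ e _ = ⊥-elim (<⇒≢ r (P-inj (<-trans r q) q e))

  P≡leftBelow+rightDegree : ∀ {x} → x < n → P x ≡ leftBelow x + rightDegree x
  P≡leftBelow+rightDegree {x} q = trans (sym (count-P< (P x) (<⇒≤ (P<n q))))
    (trans (sumBelow-splitAt (λ y → indicator (P y <ᵇ P x)) x q) (cong (λ z → leftBelow x + (indicator z + rightDegree x)) (<ᵇ-irr (P x))))

  leftDegree+rightDegree : ∀ {x} → x < n → leftDegree x + rightDegree x ≡ 3
  leftDegree+rightDegree {x} q = trans (sym (trans (sumBelow-splitAt (λ y → indicator (inverted x y)) x q)
    (cong₂ (λ a b → a + b) (sumBelow-cong _ _ x pointwise-left) (cong₂ _+_ (cong indicator invxx) (sumBelow-cong _ _ (n ∸ suc x) pointwise-right))))) (inverted-count q)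
    where
    pointwise-left : ∀ j → j < x → indicator (inverted x j) ≡ indicator (P x <ᵇ P j)
    pointwise-left j r rewrite <ᵇ-false {x} {j} (<⇒≤ r) | <ᵇ-true r = refl
    invxx : inverted x x ≡ false
    invxx rewrite <ᵇ-irr x = refl
    pointwise-right : ∀ j → j < (n ∸ suc x) → indicator (inverted x (suc x + j)) ≡ indicator (P (suc x + j) <ᵇ P x)
    pointwise-right j r rewrite <ᵇ-true {x} {suc x + j} (s≤s (m≤m+n x j)) | <ᵇ-false {suc x + j} {x} (≤-trans (n≤1+n x) (m≤m+n (suc x) j)) = cong indicator (∨-identityʳ _)

  displacement-identity : ∀ {x} → x < n → P x + 2 * leftDegree x ≡ x + 3
  displacement-identity {x} q = begin
    P x + 2 * L                   ≡⟨ cong (_+ 2 * L) (P≡leftBelow+rightDegree q) ⟩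
    (A + R) + 2 * L               ≡⟨ rearrange A L R ⟩
    (A + L) + (L + R)             ≡⟨ cong₂ _+_ (leftBelow+leftDegree q) (leftDegree+rightDegree q) ⟩
    x + 3                         ∎
    where
    A : ℕ
    A = leftBelow x
    L : ℕ
    L = leftDegree x
    R : ℕ
    R = rightDegree x
    rearrange : ∀ A L R → (A + R) + 2 * L ≡ (A + L) + (L + R)
    rearrange = solve-∀

  leftDegree≤3 : ∀ {x} → x < n → leftDegree x ≤ 3
  leftDegree≤3 {x} q = subst (leftDegree x ≤_) (leftDegree+rightDegree q) (m≤m+n (leftDegree x) (rightDegree x))

  letterOfLeftDegree : ℕ → Letter
  letterOfLeftDegree 0 = a6
  letterOfLeftDegree 1 = a4
  letterOfLeftDegree 2 = a2
  letterOfLeftDegree _ = a0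

  letter : ℕ → Letter
  letter x = letterOfLeftDegree (leftDegree x)

  letterOfLeftDegree-value : ∀ L → L ≤ 3 → val (letterOfLeftDegree L) + 2 * L ≡ 6
  letterOfLeftDegree-value 0 _ = refl
  letterOfLeftDegree-value 1 _ = refl
  letterOfLeftDegree-value 2 _ = refl
  letterOfLeftDegree-value 3 _ = refl
  letterOfLeftDegree-value (suc (suc (suc (suc _)))) (s≤s (s≤s (s≤s ())))

  letter-value : ∀ {x} → x < n → val (letter x) + x ≡ P x + 3
  letter-value {x} q = +-cancelʳ-≡ (2 * L) (val (letter x) + x) (P x + 3) (begin
    val (letter x) + x + 2 * L    ≡⟨ swap (val (letter x)) x (2 * L) ⟩
    val (letter x) + 2 * L + x    ≡⟨ cong (_+ x) (letterOfLeftDegree-value L (leftDegree≤3 q)) ⟩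
    6 + x                         ≡⟨ trans (+-comm 6 x) (sym (+-assoc x 3 3)) ⟩
    x + 3 + 3                     ≡⟨ cong (_+ 3) (displacement-identity q) ⟨
    P x + 2 * L + 3               ≡⟨ swap (P x) (2 * L) 3 ⟩
    P x + 3 + 2 * L               ∎)
    where
    L : ℕ
    L = leftDegree x
    swap : ∀ a b c → a + b + c ≡ a + c + b
    swap = solve-∀

  recent : ℕ → ℕ → Letter
  recent zero s = a3
  recent (suc k) zero = letter k
  recent (suc k) (suc s) = recent k s

  window : ℕ → Window
  window k = recent k 0 ∷ recent k 1 ∷ recent k 2 ∷ recent k 3 ∷ recent k 4 ∷ recent k 5 ∷ []

  recent-letter : ∀ x s k → x + suc s ≡ k → recent k s ≡ letter x
  recent-letter x zero (suc k) e = cong letter (sym (suc-injective (trans (sym (+-comm x 1)) e)))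
  recent-letter x (suc s) (suc k) e = recent-letter x s k (suc-injective (trans (sym (+-suc x (suc s))) e))
  recent-letter zero s zero ()
  recent-letter (suc x) s zero ()

  recent-padding : ∀ k s → k ≤ s → recent k s ≡ a3
  recent-padding zero s q = refl
  recent-padding (suc k) (suc s) (s≤s q) = recent-padding k s q

  data Lag : ℕ → Set where
    s1 : Lag 1
    s2 : Lag 2
    s3 : Lag 3
    s4 : Lag 4
    s5 : Lag 5
    s6 : Lag 6

  lookback-window : ∀ k {s} → Lag s → lookback (window k) s ≡ recent k (s ∸ 1)
  lookback-window k s1 = refl
  lookback-window k s2 = refl
  lookback-window k s3 = refl
  lookback-window k s4 = refl
  lookback-window k s5 = refl
  lookback-window k s6 = refl

  Lag≥1 : ∀ {s} → Lag s → 1 ≤ s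
  Lag≥1 s1 = s≤s z≤n
  Lag≥1 s2 = s≤s z≤n
  Lag≥1 s3 = s≤s z≤n
  Lag≥1 s4 = s≤s z≤n
  Lag≥1 s5 = s≤s z≤n
  Lag≥1 s6 = s≤s z≤n

  toLag : ∀ s → 1 ≤ s → s ≤ 6 → Lag s
  toLag 1 _ _ = s1
  toLag 2 _ _ = s2
  toLag 3 _ _ = s3
  toLag 4 _ _ = s4
  toLag 5 _ _ = s5
  toLag 6 _ _ = s6
  toLag (suc (suc (suc (suc (suc (suc (suc s))))))) _ (s≤s (s≤s (s≤s (s≤s (s≤s (s≤s ())))))) 

  lagValue : ℕ → ℕ → ℕ
  lagValue k s = val (lookback (window k) s)

  lagValue-letter : ∀ k {s} x → Lag s → x + s ≡ k → lagValue k s ≡ val (letter x)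
  lagValue-letter k {s} x q e = cong val (trans (lookback-window k q) (recent-letter x (s ∸ 1) k (trans (cong (x +_) (m+[n∸m]≡n' q)) e)))
    where
    m+[n∸m]≡n' : ∀ {s} → Lag s → suc (s ∸ 1) ≡ s
    m+[n∸m]≡n' s1 = refl
    m+[n∸m]≡n' s2 = refl
    m+[n∸m]≡n' s3 = refl
    m+[n∸m]≡n' s4 = refl
    m+[n∸m]≡n' s5 = refl
    m+[n∸m]≡n' s6 = refl

  lagValue-padding : ∀ k {s} → Lag s → k < s → lagValue k s ≡ 3
  lagValue-padding k {s} q r = cong val (trans (lookback-window k q) (recent-padding k (s ∸ 1) (pred≤ q r)))
    where
    pred≤ : ∀ {s} → Lag s → k < s → k ≤ s ∸ 1
    pred≤ s1 (s≤s r) = r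
    pred≤ s2 (s≤s r) = r
    pred≤ s3 (s≤s r) = r
    pred≤ s4 (s≤s r) = r
    pred≤ s5 (s≤s r) = r
    pred≤ s6 (s≤s r) = r

  val≤6 : ∀ l → val l ≤ 6
  val≤6 a0 = z≤n
  val≤6 a2 = s≤s (s≤s z≤n)
  val≤6 a3 = s≤s (s≤s (s≤s z≤n))
  val≤6 a4 = s≤s (s≤s (s≤s (s≤s z≤n)))
  val≤6 a6 = ≤-refl

  letter-or-padding : ∀ k s → (Σ ℕ λ x → x + s ≡ k) ⊎ (k < s)
  letter-or-padding k s with s ≤? k
  ... | yes q = inj₁ (k ∸ s , m∸n+n≡m q)
  ... | no q = inj₂ (≰⇒> q)

  all6-intro : ∀ f → (∀ {s} → Lag s → T (f s)) → T (all6 f)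
  all6-intro f h = T-∧-intro (h s1) (T-∧-intro (h s2) (T-∧-intro (h s3) (T-∧-intro (h s4) (T-∧-intro (h s5) (h s6)))))

  any6-intro : ∀ f {s} → Lag s → T (f s) → T (any6 f)
  any6-intro f s1 t = T-∨-introˡ t
  any6-intro f s2 t = T-∨-introʳ {f 1} (T-∨-introˡ t)
  any6-intro f s3 t = T-∨-introʳ {f 1} (T-∨-introʳ {f 2} (T-∨-introˡ t))
  any6-intro f s4 t = T-∨-introʳ {f 1} (T-∨-introʳ {f 2} (T-∨-introʳ {f 3} (T-∨-introˡ t)))
  any6-intro f s5 t = T-∨-introʳ {f 1} (T-∨-introʳ {f 2} (T-∨-introʳ {f 3} (T-∨-introʳ {f 4} (T-∨-introˡ t))))
  any6-intro f s6 t = T-∨-introʳ {f 1} (T-∨-introʳ {f 2} (T-∨-introʳ {f 3} (T-∨-introʳ {f 4} (T-∨-introʳ {f 5} t))))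

  any6-none : ∀ f → (∀ {s} → Lag s → f s ≡ false) → any6 f ≡ false
  any6-none f h rewrite h s1 | h s2 | h s3 | h s4 | h s5 | h s6 = refl

  sum6-cong : ∀ g h → (∀ {s} → Lag s → g s ≡ h s) → sum6 g ≡ sum6 h
  sum6-cong g h e rewrite e s1 | e s2 | e s3 | e s4 | e s5 | e s6 = refl

  E : ℕ → ℕ
  E x = val (letter x)

  k≤P+3 : ∀ {k} → k < n → k ≤ P k + 3
  k≤P+3 {k} q = subst (k ≤_) (letter-value q) (m≤n+m k (E k))

  window-injective : ∀ {k} → k < n → T (injectiveAt (window k) (E k))
  window-injective {k} q = all6-intro _ (λ {s} r → T-not (≡ᵇ-false (ne r)))
    where
    ne : ∀ {s} → Lag s → lagValue k s ≢ s + E k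
    ne {s} r e with letter-or-padding k s
    ... | inj₁ (x , xs) = <⇒≢ (m<m+n x {s} (Lag≥1 r)) (trans xk (sym xs))
      where
      x<n : x < n
      x<n = ≤-<-trans (m≤m+n x s) (subst (_< n) (sym xs) q)
      e1 : E x + x ≡ E k + k
      e1 = trans (cong (_+ x) (trans (sym (lagValue-letter k x r xs)) e)) (trans (+-assoc s (E k) x) (trans (cong (s +_) (+-comm (E k) x)) (trans (sym (+-assoc s x (E k))) (trans (cong (_+ E k) (trans (+-comm s x) xs)) (+-comm k (E k))))))
      xk : x ≡ k
      xk = P-inj x<n q (+-cancelʳ-≡ 3 (P x) (P k) (trans (sym (letter-value x<n)) (trans e1 (letter-value q))))
    ... | inj₂ ks = <⇒≢ lt (trans (sym (lagValue-padding k r ks)) e)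
      where
      lt : 3 < s + E k
      lt = ≤-trans (s≤s (subst (3 ≤_) (trans (sym (letter-value q)) (+-comm (E k) k)) (m≤n+m 3 (P k)))) (+-monoˡ-≤ (E k) ks)

  lagAbove : ℕ → ℕ → ℕ
  lagAbove k s = indicator ((s + E k) <ᵇ lagValue k s)

  above : ℕ → ℕ → ℕ
  above k j = indicator (P k <ᵇ P j)

  lagAbove-letter : ∀ {k} → k < n → ∀ {s} → Lag s → ∀ x → x + s ≡ k → lagAbove k s ≡ above k x
  lagAbove-letter {k} q {s} r x xs = cong indicator (trans (cong ((s + E k) <ᵇ_) (lagValue-letter k x r xs)) (<ᵇ-cong f g))
    where
    x<n : x < n
    x<n = ≤-<-trans (m≤m+n x s) (subst (_< n) (sym xs) q)
    A : (s + E k) + x ≡ P k + 3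
    A = trans (trans (+-comm (s + E k) x) (trans (sym (+-assoc x s (E k))) (trans (cong (_+ E k) xs) (+-comm k (E k))))) (letter-value q)
    f : s + E k < E x → P k < P x
    f h = +-cancelʳ-< 3 (P k) (P x) (subst₂ _<_ A (letter-value x<n) (+-monoˡ-< x h))
    g : P k < P x → s + E k < E x
    g h = +-cancelʳ-< x (s + E k) (E x) (subst₂ _<_ (sym A) (sym (letter-value x<n)) (+-monoˡ-< 3 h))

  lagAbove-padding : ∀ {k} → k < n → ∀ {s} → Lag s → k < s → lagAbove k s ≡ 0
  lagAbove-padding {k} q {s} r ks = cong indicator (trans (cong ((s + E k) <ᵇ_) (lagValue-padding k r ks)) (<ᵇ-false lt))
    where
    lt : 3 ≤ s + E k
    lt = ≤-trans (subst (3 ≤_) (trans (sym (letter-value q)) (+-comm (E k) k)) (m≤n+m 3 (P k))) (+-monoˡ-≤ (E k) (<⇒≤ ks))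

  above-far : ∀ {k} → k < n → ∀ j → j + 6 < k → above k j ≡ 0
  above-far {k} q j r = cong indicator (<ᵇ-false (<⇒≤ lt))
    where
    j<n : j < n
    j<n = <-trans (≤-<-trans (m≤m+n j 6) r) q
    ej : P j + 3 ≤ j + 6
    ej = subst (_≤ j + 6) (trans (+-comm j (E j)) (letter-value j<n)) (+-monoʳ-≤ j (val≤6 (letter j)))
    lt : P j < P k
    lt = +-cancelʳ-< 3 (P j) (P k) (≤-trans (s≤s ej) (≤-trans r (k≤P+3 q)))

  aboveAtLag : ℕ → ℕ → ℕ
  aboveAtLag k s = if s Data.Nat.≤ᵇ k then above k (k ∸ s) else 0

  lagAbove≡aboveAtLag : ∀ {k} → k < n → ∀ {s} → Lag s → lagAbove k s ≡ aboveAtLag k s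
  lagAbove≡aboveAtLag {k} q {s} r with letter-or-padding k s
  ... | inj₁ (x , xs) rewrite ≤ᵇ-true (subst (s ≤_) xs (m≤n+m s x)) = trans (lagAbove-letter q r x xs) (cong (above k) (sym (trans (cong (_∸ s) (sym xs)) (m+n∸n≡m x s))))
  ... | inj₂ ks rewrite ≤ᵇ-false ks = lagAbove-padding q r ks

  sum6-lagAbove : ∀ k → k < n → sum6 (lagAbove k) ≡ leftDegree k
  sum6-lagAbove 0 q = sum6-cong (lagAbove 0) (aboveAtLag 0) (lagAbove≡aboveAtLag q)
  sum6-lagAbove 1 q = sum6-cong (lagAbove 1) (aboveAtLag 1) (lagAbove≡aboveAtLag q)
  sum6-lagAbove 2 q = sum6-cong (lagAbove 2) (aboveAtLag 2) (lagAbove≡aboveAtLag q)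
  sum6-lagAbove 3 q = sum6-cong (lagAbove 3) (aboveAtLag 3) (lagAbove≡aboveAtLag q)
  sum6-lagAbove 4 q = sum6-cong (lagAbove 4) (aboveAtLag 4) (lagAbove≡aboveAtLag q)
  sum6-lagAbove 5 q = sum6-cong (lagAbove 5) (aboveAtLag 5) (lagAbove≡aboveAtLag q)
  sum6-lagAbove (suc (suc (suc (suc (suc (suc m)))))) q = trans (sum6-cong (lagAbove k) (aboveAtLag k) (lagAbove≡aboveAtLag q)) (sym e)
    where
    k : ℕ
    k = 6 + m
    F : ℕ → ℕ
    F = above k
    e : leftDegree k ≡ sum6 (aboveAtLag k)
    e = trans (cong (sumBelow F) (+-comm 6 m)) (trans (sumBelow-+ₙ F m 6)
        (trans (cong₂ _+_ (trans (sumBelow-cong F (λ _ → 0) m (λ j r → above-far q j (subst (j + 6 <_) (+-comm m 6) (+-monoˡ-< 6 r)))) (sumBelow-0 m))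
                          (sumBelow-cong (λ j → F (m + j)) (λ j → F (j + m)) 6 (λ j _ → cong F (+-comm m j)))) refl))

  window-degree : ∀ {k} → k < n → T (degreeAt (window k) (E k))
  window-degree {k} q rewrite sum6-lagAbove k q = ≡⇒≡ᵇ _ _ e
    where
    e : E k + 2 * leftDegree k ≡ 6
    e = +-cancelʳ-≡ k (E k + 2 * leftDegree k) 6 (trans (rearrange₁ (E k) k (leftDegree k)) (trans (cong (_+ 2 * leftDegree k) (letter-value q)) (trans (rearrange₂ (P k) (leftDegree k)) (trans (cong (_+ 3) (displacement-identity q)) (rearrange₃ k)))))
      where
      rearrange₁ : ∀ a b c → a + 2 * c + b ≡ a + b + 2 * c
      rearrange₁ = solve-∀
      rearrange₂ : ∀ a c → a + 3 + 2 * c ≡ a + 2 * c + 3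
      rearrange₂ = solve-∀
      rearrange₃ : ∀ a → a + 3 + 3 ≡ 6 + a
      rearrange₃ = solve-∀

  window-surjective : ∀ {k} → k < n → T (surjectiveAt (window k) (E k))
  window-surjective {k} q with k <? 3
  ... | yes k3 = T-∨-introʳ {E k ≡ᵇ 0} (any6-intro (λ s → lagValue k s ≡ᵇ s) s3 (≡⇒T (≡ᵇ-true (lagValue-padding k s3 k3))))
  ... | no k3 = go (P-surj v<n)
    where
    3≤k : 3 ≤ k
    3≤k = ≮⇒≥ k3
    v<n : k ∸ 3 < n
    v<n = ≤-<-trans (m∸n≤m k 3) q
    go : (Σ ℕ λ x → (x < n) × (P x ≡ k ∸ 3)) → T ((E k ≡ᵇ 0) ∨ any6 (λ s → lagValue k s ≡ᵇ s))
    go (x , x<n , px) with x ≟ k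
    ... | yes refl = T-∨-introˡ (≡⇒T (≡ᵇ-true (+-cancelʳ-≡ x (E x) 0 (trans exk refl))))
      where
      exk : E x + x ≡ x
      exk = trans (letter-value x<n) (trans (cong (_+ 3) px) (m∸n+n≡m 3≤k))
    ... | no xk = T-∨-introʳ {E k ≡ᵇ 0} (any6-intro (λ s → lagValue k s ≡ᵇ s) r (≡⇒T (≡ᵇ-true (lagValue-letter k x r xs))))
      where
      exk : E x + x ≡ k
      exk = trans (letter-value x<n) (trans (cong (_+ 3) px) (m∸n+n≡m 3≤k))
      xs : x + E x ≡ k
      xs = trans (+-comm x (E x)) exk
      x<k : x < k
      x<k = ≤∧≢⇒< (subst (x ≤_) exk (m≤n+m x (E x))) xk
      r : Lag (E x)
      r = toLag (E x) (+-cancelˡ-≤ x 1 (E x) (subst (_≤ x + E x) (+-comm 1 x) (subst (suc x ≤_) (sym xs) x<k))) (val≤6 (letter x))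

  window-consistent : ∀ {k} → k < n → T (consistent (window k) (letter k))
  window-consistent q = T-∧-intro (window-injective q) (T-∧-intro (window-degree q) (window-surjective q))

  window-uncut : ∀ {k} → (Σ ℕ λ j → (j < k) × (k ≤ P j)) → k < n → T (not (isCut (window k)))
  window-uncut {k} (j , jk , kp) q = T-not-not (any6-intro (λ s → (s + 2) <ᵇ lagValue k s) r (≡⇒T (trans (cong ((s + 2) <ᵇ_) (lagValue-letter k j r xs)) (<ᵇ-true lt))))
    where
    j<n : j < n
    j<n = <-trans jk q
    s : ℕ
    s = k ∸ j
    xs : j + s ≡ k
    xs = m+[n∸m]≡n (<⇒≤ jk)
    h3 : s + 3 ≤ E j
    h3 = +-cancelʳ-≤ j (s + 3) (E j) (subst₂ _≤_ (rearrange (j) s) (sym (letter-value j<n)) (subst (λ z → z + 3 ≤ P j + 3) (sym xs) (+-monoˡ-≤ 3 kp)))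
      where
      rearrange : ∀ a b → (a + b) + 3 ≡ b + 3 + a
      rearrange = solve-∀
    lt : s + 2 < E j
    lt = subst (_≤ E j) (+-suc s 2) h3
    r : Lag s
    r = toLag s (subst (1 ≤_) refl (m<n⇒0<n∸m jk)) (≤-trans (m≤m+n s 3) (≤-trans h3 (val≤6 (letter j))))

  end-window-cut : isCut (window n) ≡ true
  end-window-cut = cong not (any6-none (λ s → (s + 2) <ᵇ lagValue n s) pointwise)
    where
    pointwise : ∀ {s} → Lag s → ((s + 2) <ᵇ lagValue n s) ≡ false
    pointwise {s} r with letter-or-padding n s
    ... | inj₁ (x , xs) = trans (cong ((s + 2) <ᵇ_) (lagValue-letter n x r xs)) (<ᵇ-false le)
      where
      x<n : x < n
      x<n = subst (x <_) xs (m<m+n x (Lag≥1 r))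
      le : E x ≤ s + 2
      le = ≤-pred (subst (suc (E x) ≤_) (+-suc s 2) (+-cancelʳ-< x (E x) (s + 3) shifted<))
        where
        eq : n + 3 ≡ s + 3 + x
        eq = trans (cong (_+ 3) (sym xs)) (rearrange x s)
          where
          rearrange : ∀ a b → (a + b) + 3 ≡ b + 3 + a
          rearrange = solve-∀
        shifted< : E x + x < s + 3 + x
        shifted< = subst₂ _<_ (sym (letter-value x<n)) eq (+-monoˡ-< 3 (P<n x<n))
    ... | inj₂ ns = trans (cong ((s + 2) <ᵇ_) (lagValue-padding n r ns)) (<ᵇ-false (+-monoˡ-≤ 2 (Lag≥1 r)))

  end-window-attains-letter : ∀ c → c ≤ 2 → 3 ≤ n + c → T (attains (window n) c)
  end-window-attains-letter c c2 h3 = go (P-surj v<n)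
    where
    v<n : n + c ∸ 3 < n
    v<n = +-cancelʳ-< 3 (n + c ∸ 3) n (subst (_< n + 3) (sym (m∸n+n≡m h3)) (+-monoʳ-< n (s≤s c2)))
    go : (Σ ℕ λ x → (x < n) × (P x ≡ n + c ∸ 3)) → T (attains (window n) c)
    go (x , x<n , px) = any6-intro (λ s → lagValue n s ≡ᵇ (s + c)) r (≡⇒T (≡ᵇ-true (trans (lagValue-letter n x r xs) ex)))
      where
      s : ℕ
      s = n ∸ x
      xs : x + s ≡ n
      xs = m+[n∸m]≡n (<⇒≤ x<n)
      e1 : E x + x ≡ n + c
      e1 = trans (letter-value x<n) (trans (cong (_+ 3) px) (m∸n+n≡m h3))
      ex : E x ≡ s + c
      ex = +-cancelʳ-≡ x (E x) (s + c) (trans e1 (trans (cong (_+ c) (sym xs)) (rearrange x s c)))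
        where
        rearrange : ∀ a b d → a + b + d ≡ b + d + a
        rearrange = solve-∀
      r : Lag s
      r = toLag s (m<n⇒0<n∸m x<n) (≤-trans (m≤m+n s c) (subst (_≤ 6) ex (val≤6 (letter x))))

  end-window-attains : ∀ c → c ≤ 2 → T (attains (window n) c)
  end-window-attains c c2 with 3 ≤? n + c
  ... | yes h = end-window-attains-letter c c2 h
  end-window-attains 0 _ | no h = any6-intro (λ s → lagValue n s ≡ᵇ (s + 0)) s3 (≡⇒T (≡ᵇ-true (lagValue-padding n s3 (≰⇒> (λ z → h (subst (3 ≤_) (sym (+-identityʳ n)) z))))))
  end-window-attains 1 _ | no h = any6-intro (λ s → lagValue n s ≡ᵇ (s + 1)) s2 (≡⇒T (≡ᵇ-true (lagValue-padding n s2 (≰⇒> (λ z → h (subst (3 ≤_) (+-comm 1 n) (s≤s z)))))))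
  end-window-attains 2 _ | no h = any6-intro (λ s → lagValue n s ≡ᵇ (s + 2)) s1 (≡⇒T (≡ᵇ-true (lagValue-padding n s1 (≰⇒> (λ z → h (subst (3 ≤_) (+-comm 2 n) (s≤s (s≤s z))))))))
  end-window-attains (suc (suc (suc c))) (s≤s (s≤s ())) | no h

  end-window-final : T (isFinal (window n))
  end-window-final = T-∧-intro (≡⇒T end-window-cut) (T-∧-intro (end-window-attains 0 z≤n) (T-∧-intro (end-window-attains 1 (s≤s z≤n)) (end-window-attains 2 (s≤s (s≤s z≤n)))))

  search : ∀ k m → (Σ ℕ λ j → (j < m) × (k ≤ P j)) ⊎ (∀ j → j < m → P j < k)
  search k zero = inj₂ (λ j ())
  search k (suc m) with search k m
  ... | inj₁ (j , jm , kp) = inj₁ (j , ≤-trans jm (n≤1+n m) , kp)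
  ... | inj₂ h with k ≤? P m
  ...   | yes kp = inj₁ (m , ≤-refl , kp)
  ...   | no kp = inj₂ cs
    where
    cs : ∀ j → j < suc m → P j < k
    cs j jm with m≤n⇒m<n∨m≡n (≤-pred jm)
    ... | inj₁ lt = h j lt
    ... | inj₂ refl = ≰⇒> kp

  position : Fin n → ℕ
  position a = toℕ (σ ⟨$⟩ˡ a)

  position-σ : ∀ {x} (x<n : x < n) → position (σ ⟨$⟩ʳ fin x<n) ≡ x
  position-σ x<n = trans (cong toℕ (inverseˡ σ)) (toℕ-fromℕ< x<n)

  G-position : ∀ a b → G a b ≡ inverted (position a) (position b)
  G-position a b = trans (cong₂ G (sym (inverseʳ σ)) (sym (inverseʳ σ))) (G-inverted (σ ⟨$⟩ˡ a) (σ ⟨$⟩ˡ b))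

  module _ {k} (below : ∀ j → j < k → P j < k) where

    values-above : k ≤ n → ∀ y → k ≤ y → y < n → k ≤ P y
    values-above k≤n y k≤y y<n = subst (λ z → k ≤ P z) (m+[n∸m]≡n k≤y) (≮⇒≥ (λ lt → contradiction (trans (sym (cong indicator (<ᵇ-true lt))) above-zero) λ ()))
      where
      count : k + sumBelow (λ j → indicator (P (k + j) <ᵇ k)) (n ∸ k) ≡ k + 0
      count = begin
        k + sumBelow (λ j → indicator (P (k + j) <ᵇ k)) (n ∸ k)    ≡⟨ cong (_+ sumBelow (λ j → indicator (P (k + j) <ᵇ k)) (n ∸ k)) (trans (sumBelow-cong _ (λ _ → 1) k (λ y r → cong indicator (<ᵇ-true (below y r)))) (sumBelow-1 k)) ⟨
        sumBelow (λ y → indicator (P y <ᵇ k)) k + sumBelow (λ j → indicator (P (k + j) <ᵇ k)) (n ∸ k)  ≡⟨ sumBelow-+ₙ (λ y → indicator (P y <ᵇ k)) k (n ∸ k) ⟨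
        sumBelow (λ y → indicator (P y <ᵇ k)) (k + (n ∸ k))        ≡⟨ cong (sumBelow (λ y → indicator (P y <ᵇ k))) (m+[n∸m]≡n k≤n) ⟩
        sumBelow (λ y → indicator (P y <ᵇ k)) n                    ≡⟨ count-P< k k≤n ⟩
        k                                                          ≡⟨ +-identityʳ k ⟨
        k + 0                                                      ∎
      above-zero : indicator (P (k + (y ∸ k)) <ᵇ k) ≡ 0
      above-zero = sumBelow≡0⇒ (λ j → indicator (P (k + j) <ᵇ k)) (n ∸ k) (+-cancelˡ-≡ k _ 0 count) (y ∸ k) (∸-monoˡ-< y<n k≤y)

    no-edge-across : k ≤ n → ∀ a b → position a < k → k ≤ position b → G a b ≡ false
    no-edge-across k≤n a b pa pb rewrite G-position a b | <ᵇ-true (<-≤-trans pa pb) | <ᵇ-false {position b} {position a} (≤-trans (<⇒≤ pa) pb)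
      | <ᵇ-false {P (position b)} {P (position a)} (≤-trans (<⇒≤ (below (position a) pa)) (values-above k≤n (position b) pb (toℕ<n _))) = refl

    no-walk-across : k ≤ n → ∀ {u v} → Walk G u v → position u < k → k ≤ position v → ⊥
    no-walk-across k≤n here pu pv = <⇒≱ pu pv
    no-walk-across k≤n (step {u} {w} e rest) pu pv with position w <? k
    ... | yes pointwise = no-walk-across k≤n rest pointwise pv
    ... | no pointwise = contradiction (trans (sym e) (no-edge-across k≤n u w pu (≮⇒≥ pointwise))) λ ()

  crossing : ∀ k → 0 < k → k < n → Σ ℕ λ j → (j < k) × (k ≤ P j)
  crossing k 0<k k<n with search k k
  ... | inj₁ r = r
  ... | inj₂ below = ⊥-elim (no-walk-across below (<⇒≤ k<n) (proj₂ conn (σ ⟨$⟩ʳ fin 0<n) (σ ⟨$⟩ʳ fin k<n))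
                                (subst (_< k) (sym (position-σ 0<n)) 0<k) (subst (k ≤_) (sym (position-σ k<n)) ≤-refl))
    where
    0<n : 0 < n
    0<n = <-trans 0<k k<n

  wordFrom : ℕ → ℕ → List Letter
  wordFrom k zero = []
  wordFrom k (suc m) = letter k ∷ wordFrom (suc k) m

  wordFrom-accepted : ∀ m k → k + suc m ≡ n → Accepts (window k) (wordFrom k (suc m))
  wordFrom-accepted zero k e = [ T-∧-intro (window-consistent kn) (subst (λ z → T (isFinal (window z))) (sym (trans (+-comm 1 k) e)) end-window-final) ]
    where
    kn : k < n
    kn = subst (k <_) e (m<m+n k (s≤s z≤n))
  wordFrom-accepted (suc m) k e = T-∧-intro (window-consistent kn) (window-uncut (crossing (suc k) (s≤s z≤n) skn) skn) ∷ wordFrom-accepted m (suc k) (trans (sym (+-suc k (suc m))) e)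
    where
    kn : k < n
    kn = subst (k <_) e (m<m+n k (s≤s z≤n))
    skn : suc k < n
    skn = subst (suc k <_) (trans (sym (+-suc k (suc m))) e) (m<m+n (suc k) (s≤s z≤n))

  W : List Letter
  W = wordFrom 0 n

  W-accepted : Accepts blankWindow W
  W-accepted = subst (λ z → Accepts blankWindow (wordFrom 0 z)) e (wordFrom-accepted (pred n) 0 e)
    where
    e : suc (pred n) ≡ n
    e = suc-pred n ⦃ Data.Nat.>-nonZero (proj₁ conn) ⦄

  length-wordFrom : ∀ k m → length (wordFrom k m) ≡ m
  length-wordFrom k zero = refl
  length-wordFrom k (suc m) = cong suc (length-wordFrom (suc k) m)

  open WordAdjacency using (nth; dir; wordAdj)

  nth-wordFrom : ∀ k m x → x < m → nth (wordFrom k m) x ≡ letter (k + x)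
  nth-wordFrom k (suc m) zero _ = cong letter (sym (+-identityʳ k))
  nth-wordFrom k (suc m) (suc x) (s≤s q) = trans (nth-wordFrom (suc k) m x q) (cong letter (sym (+-suc k x)))

  nth-W : ∀ x → x < n → nth W x ≡ letter x
  nth-W x q = nth-wordFrom 0 n x q

  dir-W : ∀ a b → a < n → b < n → dir W a b ≡ ((a <ᵇ b) ∧ (P b <ᵇ P a))
  dir-W a b an bn with a <? b
  ... | no ab rewrite <ᵇ-false {a} {b} (≮⇒≥ ab) = refl
  ... | yes ab rewrite <ᵇ-true ab | length-wordFrom 0 n | <ᵇ-true bn | nth-W a an | nth-W b bn = <ᵇ-cong f g
    where
    A : (b ∸ a) + E b + a ≡ P b + 3
    A = trans (rearrange (b ∸ a) (E b) a) (trans (cong (E b +_) (m∸n+n≡m (<⇒≤ ab))) (trans (+-comm (E b) b) (trans (+-comm b (E b)) (letter-value bn))))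
      where
      rearrange : ∀ x y z → x + y + z ≡ y + (x + z)
      rearrange = solve-∀
    f : (b ∸ a) + E b < E a → P b < P a
    f h = +-cancelʳ-< 3 (P b) (P a) (subst₂ _<_ A (letter-value an) (+-monoˡ-< a h))
    g : P b < P a → (b ∸ a) + E b < E a
    g h = +-cancelʳ-< a ((b ∸ a) + E b) (E a) (subst₂ _<_ (sym A) (sym (letter-value an)) (+-monoˡ-< 3 h))

  G-word : ∀ i j → G (σ ⟨$⟩ʳ i) (σ ⟨$⟩ʳ j) ≡ wordAdj W (toℕ i) (toℕ j)
  G-word i j = trans (G-inverted i j) (sym (cong₂ _∨_ (dir-W (toℕ i) (toℕ j) (toℕ<n i) (toℕ<n j)) (dir-W (toℕ j) (toℕ i) (toℕ<n j) (toℕ<n i))))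

  length-W : length W ≡ n
  length-W = length-wordFrom 0 n

  W-transposable : ∀ w′ → W ≡ a6 ∷ a6 ∷ a2 ∷ a0 ∷ w′ → Transposable π
  W-transposable w′ eq = 3<n , π-1 , π-2
    where
    3<n : 3 < n
    3<n = subst (3 <_) (trans (cong length (sym eq)) length-W) (s≤s (s≤s (s≤s (s≤s z≤n))))
    E-nth : ∀ x → x < n → E x ≡ val (nth W x)
    E-nth x q = cong val (sym (nth-W x q))
    π-1 : ∀ i → toℕ i ≡ 1 → toℕ (π ⟨$⟩ʳ i) ≡ 4
    π-1 i e = trans (sym (P-toℕ i)) (trans (cong P e) (+-cancelʳ-≡ 3 (P 1) 4 (trans (sym (letter-value 1<n)) (cong (_+ 1) (trans (E-nth 1 1<n) (cong (λ w → val (nth w 1)) eq))))))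
      where
      1<n : 1 < n
      1<n = <-trans (s≤s (s≤s z≤n)) (<-trans (s≤s (s≤s (s≤s z≤n))) 3<n)
    π-2 : ∀ i → toℕ i ≡ 2 → toℕ (π ⟨$⟩ʳ i) ≡ 1
    π-2 i e = trans (sym (P-toℕ i)) (trans (cong P e) (+-cancelʳ-≡ 3 (P 2) 1 (trans (sym (letter-value 2<n)) (cong (_+ 2) (trans (E-nth 2 2<n) (cong (λ w → val (nth w 2)) eq))))))
      where
      2<n : 2 < n
      2<n = <-trans (s≤s (s≤s (s≤s z≤n))) 3<n

module _ {n m : ℕ} (G : Graph n) (H : Graph m) (σ : Permutation′ n) (A : ℕ → ℕ → Bool)
  (G-A : ∀ i j → G (σ ⟨$⟩ʳ i) (σ ⟨$⟩ʳ j) ≡ A (toℕ i) (toℕ j)) where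

  open import Data.Fin.Properties using (toℕ-injective; toℕ-fromℕ<; toℕ<n)

  isomorphic-by-relabelling : (F F⁻¹ : ℕ → ℕ) → (∀ x → x < n → F x < m) → (∀ y → y < m → F⁻¹ y < n) →
    (∀ x → F⁻¹ (F x) ≡ x) → (∀ y → F (F⁻¹ y) ≡ y) →
    (∀ (a b : Fin n) (c d : Fin m) → toℕ c ≡ F (toℕ a) → toℕ d ≡ F (toℕ b) → A (toℕ a) (toℕ b) ≡ H c d) →
    Isomorphic G H
  isomorphic-by-relabelling F F⁻¹ F< F⁻¹< F⁻¹∘F F∘F⁻¹ A-H = bijection , adjacency
    where
    f : Fin n → Fin m
    f u = fromℕ< (F< (toℕ (σ ⟨$⟩ˡ u)) (toℕ<n _))
    g : Fin m → Fin n
    g c = σ ⟨$⟩ʳ fromℕ< (F⁻¹< (toℕ c) (toℕ<n c))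
    toℕ-f : ∀ u → toℕ (f u) ≡ F (toℕ (σ ⟨$⟩ˡ u))
    toℕ-f u = toℕ-fromℕ< _
    f∘g : ∀ c → f (g c) ≡ c
    f∘g c = toℕ-injective (trans (toℕ-f (g c)) (trans (cong (λ z → F (toℕ z)) (inverseˡ σ)) (trans (cong F (toℕ-fromℕ< _)) (F∘F⁻¹ (toℕ c)))))
    g∘f : ∀ u → g (f u) ≡ u
    g∘f u = trans (cong (σ ⟨$⟩ʳ_) (toℕ-injective (trans (toℕ-fromℕ< _) (trans (cong F⁻¹ (toℕ-f u)) (F⁻¹∘F _))))) (inverseʳ σ)
    bijection : Permutation n m
    bijection = permutation f g f∘g g∘f
    adjacency : ∀ u v → G u v ≡ H (bijection ⟨$⟩ʳ u) (bijection ⟨$⟩ʳ v)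
    adjacency u v = trans (cong₂ G (sym (inverseʳ σ)) (sym (inverseʳ σ)))
      (trans (G-A (σ ⟨$⟩ˡ u) (σ ⟨$⟩ˡ v)) (A-H (σ ⟨$⟩ˡ u) (σ ⟨$⟩ˡ v) (f u) (f v) (toℕ-f u) (toℕ-f v)))

module Classification {n : ℕ} (G : Graph n) (σ π : Permutation′ n) (rep : Represents G σ π)
  (simp : IsSimple G) (reg : IsRegular 3 G) (conn : IsConnected G) where

  open import Data.Bool.Properties using () renaming (_≟_ to _≟ᵇ_)
  open import Data.Fin.Properties using (all?)
  open CubicPermutationGraph G σ π rep simp reg conn
  open Words
  open WordShapes
  open EdgeLists using (edgeAdj-≡; edgeAdj-map; mapPair)
  open WordGraph using (wordEdges)
  open WordAdjacency using (wordAdj; wordEdges-adj)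
  open BoxcarWords

  Result : Set
  Result = Isomorphic G K4 ⊎ Isomorphic G K33 ⊎ IsBoxcar G

  isomorphic-to-word : ∀ {m} (H : Graph m) (w : List Letter) → W ≡ w → length w ≡ m →
    True (all? λ c → all? λ d → wordAdj w (toℕ c) (toℕ d) ≟ᵇ H c d) → Isomorphic G H
  isomorphic-to-word {m} H w eq lw check = isomorphic-by-relabelling G H σ (wordAdj W) G-word id id
    (λ x q → subst (x <_) nm q) (λ y q → subst (y <_) (sym nm) q) (λ _ → refl) (λ _ → refl) word-H
    where
    nm : n ≡ m
    nm = trans (sym length-W) (trans (cong length eq) lw)
    word-H : ∀ (a b : Fin n) (c d : Fin m) → toℕ c ≡ toℕ a → toℕ d ≡ toℕ b → wordAdj W (toℕ a) (toℕ b) ≡ H c d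
    word-H a b c d ec ed = trans (cong₂ (wordAdj W) (sym ec) (sym ed)) (trans (cong (λ w → wordAdj w (toℕ c) (toℕ d)) eq) (toWitness check c d))

  isomorphic-to-boxcar : ∀ cs → W ≡ headWord ++ tailWord fromB cs → Isomorphic G (boxcar cs)
  isomorphic-to-boxcar cs eq = isomorphic-by-relabelling G (boxcar cs) σ (wordAdj W) G-word (relabelBoxcar cs) (unlabelBoxcar cs)
    relabel< unlabel< (unlabelBoxcar-relabel cs) (relabelBoxcar-unlabel cs) word-boxcar
    where
    n≡ : n ≡ length (headWord ++ tailWord fromB cs)
    n≡ = trans (sym length-W) (cong length eq)
    relabel< : ∀ x → x < n → relabelBoxcar cs x < boxcarSize cs
    relabel< x q = subst (relabelBoxcar cs x <_) (boxcarWord-length cs) (relabelBoxcar-bounded cs x (subst (x <_) n≡ q))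
    unlabel< : ∀ y → y < boxcarSize cs → unlabelBoxcar cs y < n
    unlabel< y q = subst (unlabelBoxcar cs y <_) (sym n≡) (unlabelBoxcar-bounded cs y (subst (y <_) (sym (boxcarWord-length cs)) q))
    relabel-injective : ∀ x y → relabelBoxcar cs x ≡ relabelBoxcar cs y → x ≡ y
    relabel-injective x y e = trans (sym (unlabelBoxcar-relabel cs x)) (trans (cong (unlabelBoxcar cs) e) (unlabelBoxcar-relabel cs y))
    word-boxcar : ∀ (a b : Fin n) (c d : Fin (boxcarSize cs)) → toℕ c ≡ relabelBoxcar cs (toℕ a) → toℕ d ≡ relabelBoxcar cs (toℕ b) → wordAdj W (toℕ a) (toℕ b) ≡ boxcar cs c d
    word-boxcar a b c d ec ed = begin
      wordAdj W (toℕ a) (toℕ b)                       ≡⟨ cong (λ w → wordAdj w (toℕ a) (toℕ b)) eq ⟩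
      wordAdj w (toℕ a) (toℕ b)                       ≡⟨ wordEdges-adj w (toℕ a) (toℕ b) ⟨
      edgeAdj (wordEdges w) (toℕ a) (toℕ b)           ≡⟨ edgeAdj-map F relabel-injective (wordEdges w) (toℕ a) (toℕ b) ⟨
      edgeAdj (map (mapPair F) (wordEdges w)) (F (toℕ a)) (F (toℕ b)) ≡⟨ edgeAdj-≡ (boxcar-edges cs) (F (toℕ a)) (F (toℕ b)) ⟩
      edgeAdj (boxcarEdges cs) (F (toℕ a)) (F (toℕ b)) ≡⟨ cong₂ (edgeAdj (boxcarEdges cs)) ec ed ⟨
      boxcar cs c d                                   ∎
      where
      w : List Letter
      w = headWord ++ tailWord fromB cs
      F : ℕ → ℕ
      F = relabelBoxcar cs

  decode : ∀ {w} → W ≡ w → Shape w → Result ⊎ Transposable π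
  decode eq shape-K4 = inj₁ (inj₁ (isomorphic-to-word K4 k4Word eq refl _))
  decode eq shape-K33 = inj₁ (inj₂ (inj₁ (isomorphic-to-word K33 k33Word eq refl _)))
  decode eq (shape-boxcar cs) = inj₁ (inj₂ (inj₂ (cs , isomorphic-to-boxcar cs eq)))
  decode eq (shape-transposable w′) = inj₂ (W-transposable w′ eq)

  classify : Result ⊎ Transposable π
  classify = decode refl (shape W-accepted)

Represents-transpose : ∀ {n} {G : Graph n} {σ π : Permutation′ n} → IsSimple G → Represents G σ π →
  Represents G (flip π ∘ₚ σ) (flip π)
Represents-transpose {n} {G} {σ} {π} (G-sym , _) rep i j i<j = mk⇔ to from
  where
  open import Data.Fin.Properties using (<-cmp; <-asym; <-irrefl)
  a : Fin n
  a = π ⟨$⟩ˡ i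
  b : Fin n
  b = π ⟨$⟩ˡ j
  π-a : π ⟨$⟩ʳ a ≡ i
  π-a = inverseʳ π
  π-b : π ⟨$⟩ʳ b ≡ j
  π-b = inverseʳ π
  to : G (σ ⟨$⟩ʳ a) (σ ⟨$⟩ʳ b) ≡ true → b <F a
  to e with <-cmp a b
  ... | tri< a<b _ _ = ⊥-elim (<-asym i<j (subst₂ _<F_ π-b π-a (Equivalence.to (rep a b a<b) e)))
  ... | tri≈ _ a≡b _ = ⊥-elim (<-irrefl (trans (sym π-a) (trans (cong (π ⟨$⟩ʳ_) a≡b) π-b)) i<j)
  ... | tri> _ _ b<a = b<a
  from : b <F a → G (σ ⟨$⟩ʳ a) (σ ⟨$⟩ʳ b) ≡ true
  from b<a = trans (G-sym _ _) (Equivalence.from (rep b a b<a) (subst₂ _<F_ (sym π-a) (sym π-b) i<j))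

transposable-flip : ∀ {n} {π : Permutation′ n} → Transposable π → ¬ Transposable (flip π)
transposable-flip {n} {π} (3<n , _ , π-2) (_ , π⁻¹-1 , _) = 2≢4 (trans (sym π⁻¹-1≡2) (π⁻¹-1 i1 (toℕ-fromℕ< 1<n)))
  where
  open import Data.Fin.Properties using (toℕ-injective; toℕ-fromℕ<)
  1<n : 1 < n
  1<n = <-trans (s≤s (s≤s z≤n)) (<-trans (s≤s (s≤s (s≤s z≤n))) 3<n)
  2<n : 2 < n
  2<n = <-trans (s≤s (s≤s (s≤s z≤n))) 3<n
  i1 : Fin n
  i1 = fromℕ< 1<n
  i2 : Fin n
  i2 = fromℕ< 2<n
  π-i2 : π ⟨$⟩ʳ i2 ≡ i1
  π-i2 = toℕ-injective (trans (π-2 i2 (toℕ-fromℕ< 2<n)) (sym (toℕ-fromℕ< 1<n)))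
  π⁻¹-1≡2 : toℕ (flip π ⟨$⟩ʳ i1) ≡ 2
  π⁻¹-1≡2 = trans (cong (λ z → toℕ (π ⟨$⟩ˡ z)) (sym π-i2)) (trans (cong toℕ (inverseˡ π)) (toℕ-fromℕ< 2<n))
  2≢4 : 2 ≢ 4
  2≢4 ()

corollary4p6 : ∀ (n : ℕ) (G : Graph n) → IsSimple G → IsConnected G →
    IsRegular 3 G → IsPermutationGraph G →
    Isomorphic G K4 ⊎ Isomorphic G K33 ⊎ IsBoxcar G
corollary4p6 n G simp conn reg (σ , π , rep) with Classification.classify G σ π rep simp reg conn
... | inj₁ result = result
... | inj₂ transposable with Classification.classify G (flip π ∘ₚ σ) (flip π) (Represents-transpose {G = G} {σ} {π} simp rep) simp reg conn
...   | inj₁ result = result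
...   | inj₂ transposable′ = ⊥-elim (transposable-flip {π = π} transposable transposable′)
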